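{- Let $j\ge 1$, $\lambda\ge 1$, $s\ge 0$ be integers, let $\mathcal K$ and $w=w_{j,s,\lambda}$ be as in the context, and let $n>3+2s+\lambda j$. Then the pruned tree $\mathcal P\mathcal K(n)$ coincides (as a labeled tree) with $\mathcal K\bigl(n-s-w(n-j)\bigr)$, and consequently $$w(n)=w\bigl(n-s-w(n-j)\bigr)+\lambda j .$$
   Context: Construction of the labeled tree $\mathcal K$ (parameters $j\ge1,\lambda\ge1,s\ge0$). There are "supernodes" $S_0,S_1,\dots$ with an edge $S_i$–$S_{i+1}$ for all $i\ge0$; $S_0$ is the root. $S_0$ has two further children: the "initial leaf" $L_*$ and a node $L_0$ which is a leaf of $\mathcal K$. For $i\ge1$, $S_i$ has one further child, the "knot node" $N_i$, and below $N_i$ hang $\lambda$ chains (paths) of $ij$ nodes each, the top node of each chain being a child of $N_i$; the bottom node of each chain is a leaf of $\mathcal K$. Let $\mathcal K_0$ be the subtree $S_0$–$L_0$ and, for $i\ge1$, $\mathcal K_i$ the subtree formed by $S_i$, $N_i$ and the $\lambda$ chains below $N_i$. Labels: each supernode receives $s$ labels, every other node exactly one; the labels $1,2,3,\dots$ are assigned consecutively in the order (called pre-order): $L_*$, $S_0$, $L_0$, then for $i=1,2,\dots$: $S_i$, $N_i$, then the $\lambda$ chains below $N_i$ left to right, each from its top node down to its leaf. Weights: $L_*$ has weight $1$, every other leaf of $\mathcal K$ has weight $j$; $w(n)$ is the total weight of the leaves of $\mathcal K$ with label $\le n$. $\mathcal K(n)$ denotes the labeled subtree of $\mathcal K$ consisting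 of the nodes carrying a label $\le n$, with all labels $>n$ discarded. If $\mathcal K(n)$ meets $\mathcal K_0,\dots,\mathcal K_m$ (and not $\mathcal K_{m+1}$), write $\mathcal K^*_m$ for the part of $\mathcal K_m$ lying in $\mathcal K(n)$. Pruning $\mathcal P\mathcal K(n)$: (1) disconnect $L_*$ and delete $S_0$ and $L_0$ with their labels; (2) for each $1\le i<m$, delete from each of the $\lambda$ chains of $\mathcal K_i$ its $j$ nodes with the largest labels (so $\mathcal K_i$ becomes a copy of $\mathcal K_{i-1}$); (3) in $\mathcal K^*_m$: if at least two chains below $N_m$ contain nodes of $\mathcal K^*_m$, delete the $j$ largest-labeled nodes from each such chain having at least $j$ labeled nodes; otherwise, if $\mathcal K^*_m$ has at least $j$ labels in total, delete its $j$ largest labels and every node left without labels; otherwise do nothing; (4) reattach $L_*$ as a child of the supernode that was $S_1$, and relabel all remaining label positions by consecutive integers starting at $1$ in pre-order. -}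

module Defs where

open import Data.Nat using (ℕ; zero; suc; _+_; _*_; _∸_; _≡ᵇ_; _≤ᵇ_; _<ᵇ_; _⊔_; _⊓_)
open import Data.Bool using (Bool; true; false; _∧_; _∨_; not; if_then_else_)
open import Data.List using (List; []; _∷_; _++_; map; concatMap; length; reverse; foldr; filterᵇ)
open import Data.Nat.ListAction using (sum)
open import Data.List.Relation.Binary.Pointwise using (Pointwise)
open import Data.List.Relation.Binary.Permutation.Propositional using (_↭_)
open import Data.Maybe using (Maybe; just; nothing)
open import Data.Product using (_×_; _,_; proj₁; proj₂)

-- Abstract finite labeled rooted trees and their equality "as labeled
-- trees": equal label lists at corresponding nodes, children matched up
-- to reordering.

data LTree : Set where
  node : List ℕ → List LTree → LTree

data _≈T_ : LTree → LTree → Set where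
  node≈ : ∀ {ls cs cs′} ds → cs′ ↭ ds → Pointwise _≈T_ cs ds →
          node ls cs ≈T node ls cs′

-- Node positions of the infinite tree 𝒦.
--   lstar      : the initial leaf L_*
--   sup i      : supernode S_i
--   l0         : the leaf L_0
--   knot i     : knot node N_i (i ≥ 1)
--   ch i c d   : node at depth d (1 ≤ d ≤ i*j, d = 1 is the top) of the
--                chain number c (0 ≤ c < λ, left to right) below N_i

data Pos : Set where
  lstar : Pos
  sup   : ℕ → Pos
  l0    : Pos
  knot  : ℕ → Pos
  ch    : ℕ → ℕ → ℕ → Pos

_==P_ : Pos → Pos → Bool
lstar ==P lstar = true
sup i ==P sup k = i ≡ᵇ k
l0 ==P l0 = true
knot i ==P knot k = i ≡ᵇ k
ch i c d ==P ch i′ c′ d′ = (i ≡ᵇ i′) ∧ ((c ≡ᵇ c′) ∧ (d ≡ᵇ d′))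
_ ==P _ = false

parentK : Pos → Maybe Pos
parentK lstar = just (sup 0)
parentK (sup zero) = nothing
parentK (sup (suc i)) = just (sup i)
parentK l0 = just (sup 0)
parentK (knot i) = just (sup i)
parentK (ch i c zero) = nothing
parentK (ch i c (suc zero)) = just (knot i)
parentK (ch i c (suc (suc d))) = just (ch i c (suc d))

parentP : Pos → Maybe Pos
parentP lstar = just (sup 1)
parentP (sup i) = parentK (sup i)
parentP l0 = parentK l0
parentP (knot i) = parentK (knot i)
parentP (ch i c d) = parentK (ch i c d)

-- A (finite) labeled subtree is described by the list of its nodes in
-- pre-order, each with its number of label positions ("Entry").  Labels
-- are then the consecutive integers 1,2,3,... in that order ("LEntry").

Entry : Set
Entry = Pos × ℕ

LEntry : Set
LEntry = Pos × List ℕ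

range : ℕ → ℕ → List ℕ
range a zero = []
range a (suc k) = a ∷ range (suc a) k

labelize : ℕ → List Entry → List LEntry
labelize start [] = []
labelize start ((p , c) ∷ es) = (p , range start c) ∷ labelize (start + c) es

labelsAt : List LEntry → Pos → List ℕ
labelsAt [] p = []
labelsAt ((q , ls) ∷ es) p = if q ==P p then ls else labelsAt es p

isParent : Maybe Pos → Pos → Bool
isParent nothing p = false
isParent (just q) p = q ==P p

childrenOf : (Pos → Maybe Pos) → List LEntry → Pos → List Pos
childrenOf par es p = map proj₁ (filterᵇ (λ e → isParent (par (proj₁ e)) p) es)

grow : (Pos → Maybe Pos) → List LEntry → ℕ → Pos → LTree
grow par es zero p = node (labelsAt es p) []
grow par es (suc f) p = node (labelsAt es p) (map (grow par es f) (childrenOf par es p))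

toTree : (Pos → Maybe Pos) → Pos → List LEntry → LTree
toTree par root es = grow par es (suc (length es)) root

chainK : (j i c : ℕ) → List Entry
chainK j i c = map (λ d → (ch i c d , 1)) (range 1 (i * j))

segment : (j lam s i : ℕ) → List Entry
segment j lam s zero = (sup 0 , s) ∷ (l0 , 1) ∷ []
segment j lam s (suc i) =
  (sup (suc i) , s) ∷ (knot (suc i) , 1) ∷ concatMap (chainK j (suc i)) (range 0 lam)

enumK : (j lam s M : ℕ) → List Entry
enumK j lam s M = (lstar , 1) ∷ concatMap (segment j lam s) (range 0 (suc M))

-- keep the nodes carrying a label ≤ r (a supernode with s = 0 carries no
-- label and is kept iff its child N_i is kept, i.e. iff fewer than r
-- labels precede it)
trunc : ℕ → List Entry → List Entry
trunc _ [] = []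
trunc zero (_ ∷ _) = []
trunc (suc r) ((p , c) ∷ es) = (p , c ⊓ suc r) ∷ trunc (suc r ∸ c) es

-- 𝒦(n) as node list (𝒦_0 … 𝒦_n certainly contain more than n labels)
Klist : (j lam s n : ℕ) → List Entry
Klist j lam s n = trunc n (enumK j lam s n)

Ktree : (j lam s n : ℕ) → LTree
Ktree j lam s n = toTree parentK (sup 0) (labelize 1 (Klist j lam s n))

leafWeight : ℕ → Pos → ℕ
leafWeight j lstar = 1
leafWeight j l0 = j
leafWeight j (ch i c d) = if d ≡ᵇ i * j then j else 0
leafWeight j (sup _) = 0
leafWeight j (knot _) = 0

w : (j lam s n : ℕ) → ℕ
w j lam s n = sum (map (λ e → leafWeight j (proj₁ e)) (Klist j lam s n))

inK : ℕ → Pos → Bool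
inK i lstar = false
inK i (sup k) = i ≡ᵇ k
inK i l0 = i ≡ᵇ 0
inK i (knot k) = i ≡ᵇ k
inK i (ch k _ _) = i ≡ᵇ k

idxOf : Pos → ℕ
idxOf lstar = 0
idxOf (sup k) = k
idxOf l0 = 0
idxOf (knot k) = k
idxOf (ch k _ _) = k

maxIdx : List Entry → ℕ
maxIdx = foldr (λ e acc → idxOf (proj₁ e) ⊔ acc) 0

isSup : Pos → Bool
isSup (sup _) = true
isSup _ = false

onChain : ℕ → ℕ → Pos → Bool
onChain i c (ch i′ c′ _) = (i ≡ᵇ i′) ∧ (c ≡ᵇ c′)
onChain i c _ = false

-- step (1): remove S_0 and L_0 (L_* is kept; it is reattached in step 4)
step1 : List Entry → List Entry
step1 = filterᵇ (λ e → not (inK 0 (proj₁ e)))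

-- step (2): for 1 ≤ i < m delete the j deepest (= largest-labeled) nodes
-- of each (complete) chain of 𝒦_i
del2 : ℕ → ℕ → Pos → Bool
del2 j m (ch i c d) = (1 ≤ᵇ i) ∧ ((i <ᵇ m) ∧ ((i * j ∸ j) <ᵇ d))
del2 j m _ = false

step2 : ℕ → ℕ → List Entry → List Entry
step2 j m = filterᵇ (λ e → not (del2 j m (proj₁ e)))

-- step (3), acting on the node list E of 𝒦*_m
chainLen : ℕ → List Entry → ℕ → ℕ
chainLen m E c = length (filterᵇ (λ e → onChain m c (proj₁ e)) E)

nChains : ℕ → ℕ → List Entry → ℕ
nChains lam m E = length (filterᵇ (λ c → 1 ≤ᵇ chainLen m E c) (range 0 lam))

totalLabels : List Entry → ℕ
totalLabels E = sum (map proj₂ E)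

-- (3a) delete the j largest-labeled nodes of each chain having ≥ j nodes
cut3 : ℕ → ℕ → List Entry → Pos → Bool
cut3 j m E (ch i c d) =
  (j ≤ᵇ chainLen m E c) ∧ ((chainLen m E c ∸ j) <ᵇ d)
cut3 j m E _ = false

case3a : ℕ → ℕ → List Entry → List Entry
case3a j m E = filterᵇ (λ e → not (cut3 j m E (proj₁ e))) E

stripR : ℕ → List Entry → List Entry
stripR zero es = es
stripR (suc k) [] = []
stripR (suc k) ((p , c) ∷ es) = (p , c ∸ suc k) ∷ stripR (suc k ∸ c) es

-- (3b) delete the j largest labels and every node left without labels
-- (a label-free supernode S_m (case s = 0) is kept as long as some node
-- of 𝒦*_m still carries a label)
cleanup : List Entry → List Entry
cleanup E = filterᵇ (λ e → (1 ≤ᵇ proj₂ e) ∨ (isSup (proj₁ e) ∧ (1 ≤ᵇ totalLabels E))) E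

case3b : ℕ → List Entry → List Entry
case3b j E = cleanup (reverse (stripR j (reverse E)))

step3 : (j lam m : ℕ) → List Entry → List Entry
step3 j lam m E =
  if 2 ≤ᵇ nChains lam m E then case3a j m E
  else if j ≤ᵇ totalLabels E then case3b j E
  else E

prune : (j lam s : ℕ) → List Entry → List Entry
prune j lam s es =
  filterᵇ (λ e → not (inK m (proj₁ e))) es2
    ++ step3 j lam m (filterᵇ (λ e → inK m (proj₁ e)) es2)
  where
    m = maxIdx es
    es2 = step2 j m (step1 es)

PKtree : (j lam s n : ℕ) → LTree
PKtree j lam s n = toTree parentP (sup 1) (labelize 1 (prune j lam s (Klist j lam s n)))

-- 𝒦(n) consists of L_*, the complete subtrees 𝒦_0, …, 𝒦_{m-1} and a nonempty truncation 𝒦*_m of 𝒦_m,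
-- and the bound on n forces m ≥ 2. Steps (1) and (2) delete 𝒦_0 and shorten each chain of 𝒦_1, …, 𝒦_{m-1}
-- by j, which leaves exactly the image of 𝒦_0, …, 𝒦_{m-2} under the index shift 𝒦_i ↦ 𝒦_{i+1}; re-attaching
-- L_* below S_1 makes the parent map the shifted parent map of 𝒦. Hence 𝒫𝒦(n) is the shifted image of some 𝒦(a)
-- once step (3) turns 𝒦*_m into the shifted image of a truncation of 𝒦_{m-1}. The truncation 𝒦*_m is either
-- a part of the labels of S_m, or S_m, N_m, q full chains and a partial chain of u nodes; comparing the
-- number of its labels with j, u with j and q with 1 gives seven cases, in each of which step (3) is
-- computed explicitly, preserves the weight, and counting labels identifies a with n − s − w(n − j).
-- Since every complete 𝒦_i with i ≥ 1 has weight λj, also w(n) = w(a) + λj.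

module Submission where

open import Defs
open import Data.Nat using (ℕ; _+_; _*_; _∸_; _≤_; _<_)
open import Data.Product using (_×_)
open import Relation.Binary.PropositionalEquality using (_≡_)

open import Data.Bool using (Bool; true; false; T; not; _∧_; _∨_; if_then_else_)
open import Data.Bool.Properties using (T-≡; ∨-zeroʳ)
open import Data.Empty using (⊥-elim)
open import Data.List using (List; []; _∷_; _++_; map; concat; concatMap; filterᵇ; length; reverse)
open import Data.List.Properties
  using (filter-all; filter-none; filter-++; map-cong-local; map-++; map-∘; reverse-map; reverse-++; reverse-involutive;
         length-map; length-++; ++-identityʳ; ++-assoc; concatMap-++; concatMap-cong; map-concatMap)
open import Data.List.Relation.Binary.Permutation.Propositional using (↭-refl)
open import Data.List.Relation.Binary.Permutation.Propositional.Properties using (↭-reverse)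
open import Data.List.Relation.Binary.Pointwise using (Pointwise; []; _∷_)
open import Data.List.Relation.Unary.All as All using (All; []; _∷_)
open import Data.List.Relation.Unary.All.Properties using (map⁺; filter⁺; ++⁺; concat⁺)
open import Data.Nat using (zero; suc; _≡ᵇ_; _≤ᵇ_; _<ᵇ_; _⊓_; _⊔_; z≤n; s≤s; z<s)
open import Data.Nat.DivMod using (_/_; _%_; m≡m%n+[m/n]*n; m%n<n)
open import Data.Nat.ListAction using (sum)
open import Data.Nat.ListAction.Properties using (sum-++; sum-↭)
open import Data.Nat.Properties
open import Data.Nat.Tactic.RingSolver using (solve-∀)
open import Data.Product using (_,_; proj₁; proj₂; ∃; ∃₂)
open import Data.Sum using (inj₁; inj₂)
open import Data.Unit using (⊤; tt)
open import Function using (_∘_; Equivalence)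
open import Relation.Binary.PropositionalEquality using (_≢_; refl; sym; trans; cong; cong₂; subst; subst₂; module ≡-Reasoning)
open import Relation.Nullary using (¬_; Dec; yes; no)
open import Relation.Nullary.Decidable using (T?)

T-true : ∀ {b} → T b → b ≡ true
T-true = Equivalence.to T-≡

T-false : ∀ {b} → ¬ T b → b ≡ false
T-false {false} _ = refl
T-false {true} ¬t = ⊥-elim (¬t tt)

≡ᵇ-refl : ∀ n → (n ≡ᵇ n) ≡ true
≡ᵇ-refl n = T-true (≡⇒≡ᵇ n n refl)

≡ᵇ-false : ∀ {m n} → m ≢ n → (m ≡ᵇ n) ≡ false
≡ᵇ-false {m} {n} m≢n = T-false (m≢n ∘ ≡ᵇ⇒≡ m n)

<ᵇ-true : ∀ {m n} → m < n → (m <ᵇ n) ≡ true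
<ᵇ-true = T-true ∘ <⇒<ᵇ

<ᵇ-false : ∀ {m n} → n ≤ m → (m <ᵇ n) ≡ false
<ᵇ-false {m} {n} n≤m = T-false (≤⇒≯ n≤m ∘ <ᵇ⇒< m n)

≤ᵇ-true : ∀ {m n} → m ≤ n → (m ≤ᵇ n) ≡ true
≤ᵇ-true = T-true ∘ ≤⇒≤ᵇ

≤ᵇ-false : ∀ {m n} → n < m → (m ≤ᵇ n) ≡ false
≤ᵇ-false {m} {n} n<m = T-false (<⇒≱ n<m ∘ ≤ᵇ⇒≤ m n)

module _ {A : Set} where

  filterᵇ-all : (p : A → Bool) {xs : List A} → All (λ x → p x ≡ true) xs → filterᵇ p xs ≡ xs
  filterᵇ-all p = filter-all (T? ∘ p) ∘ All.map (λ px → subst T (sym px) tt)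

  filterᵇ-none : (p : A → Bool) {xs : List A} → All (λ x → p x ≡ false) xs → filterᵇ p xs ≡ []
  filterᵇ-none p = filter-none (T? ∘ p) ∘ All.map (λ px t → subst T px t)

  filterᵇ-++ : (p : A → Bool) (xs ys : List A) → filterᵇ p (xs ++ ys) ≡ filterᵇ p xs ++ filterᵇ p ys
  filterᵇ-++ p = filter-++ (T? ∘ p)

  filterᵇ-concatMap : ∀ {B : Set} (p : A → Bool) (f : B → List A) xs →
    filterᵇ p (concatMap f xs) ≡ concatMap (filterᵇ p ∘ f) xs
  filterᵇ-concatMap p f [] = refl
  filterᵇ-concatMap p f (x ∷ xs) = trans (filterᵇ-++ p (f x) _) (cong (filterᵇ p (f x) ++_) (filterᵇ-concatMap p f xs))

  filterᵇ-map : ∀ {B : Set} (p : A → Bool) (q : B → Bool) (f : A → B) {xs} →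
    All (λ x → q (f x) ≡ p x) xs → filterᵇ q (map f xs) ≡ map f (filterᵇ p xs)
  filterᵇ-map p q f [] = refl
  filterᵇ-map p q f {x ∷ xs} (qfx ∷ qs) with p x | q (f x)
  ... | true  | true  = cong (f x ∷_) (filterᵇ-map p q f qs)
  ... | false | false = filterᵇ-map p q f qs

  filterᵇ-single : (p : A → Bool) (x : A) → filterᵇ p (x ∷ []) ≡ (if p x then x ∷ [] else [])
  filterᵇ-single p x with p x
  ... | true  = refl
  ... | false = refl

concatMap-cong-local : ∀ {A B : Set} {f g : A → List B} {xs} → All (λ x → f x ≡ g x) xs → concatMap f xs ≡ concatMap g xs
concatMap-cong-local = cong concat ∘ map-cong-local

totalLabels-++ : ∀ xs ys → totalLabels (xs ++ ys) ≡ totalLabels xs + totalLabels ys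
totalLabels-++ xs ys = trans (cong sum (map-++ proj₂ xs ys)) (sum-++ (map proj₂ xs) (map proj₂ ys))

totalLabels-reverse : ∀ xs → totalLabels (reverse xs) ≡ totalLabels xs
totalLabels-reverse xs = trans (cong sum (reverse-map proj₂ xs)) (sum-↭ (↭-reverse (map proj₂ xs)))

range-++ : ∀ a b c → range a (b + c) ≡ range a b ++ range (a + b) c
range-++ a zero    c = cong (λ x → range x c) (sym (+-identityʳ a))
range-++ a (suc b) c = cong (a ∷_) (trans (range-++ (suc a) b c) (cong (λ x → range (suc a) b ++ range x c) (sym (+-suc a b))))

length-range : ∀ a n → length (range a n) ≡ n
length-range a zero    = refl
length-range a (suc n) = cong suc (length-range (suc a) n)

All-range : ∀ {P : ℕ → Set} a n → (∀ d → a ≤ d → d < a + n → P d) → All P (range a n)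
All-range a zero    f = []
All-range a (suc n) f =
  f a ≤-refl (m<m+n a z<s) ∷ All-range (suc a) n (λ d a<d d<a+1+n → f d (<⇒≤ a<d) (subst (d <_) (sym (+-suc a n)) d<a+1+n))

range-split : ∀ {q n} → q < n → range 0 n ≡ range 0 q ++ (q ∷ range (suc q) (n ∸ suc q))
range-split {q} {n} q<n = trans (cong (range 0) (sym (trans (+-suc q _) (m+[n∸m]≡n q<n)))) (range-++ 0 q _)

concatMap-range-split : ∀ {A : Set} (f : ℕ → List A) {c q} → c < q →
  concatMap f (range 0 q) ≡ concatMap f (range 0 c) ++ (f c ++ concatMap f (range (suc c) (q ∸ suc c)))
concatMap-range-split f {c} c<q = trans (cong (concatMap f) (range-split c<q)) (concatMap-++ f (range 0 c) _)

units : (ℕ → Pos) → ℕ → ℕ → List Entry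
units g a n = map (λ d → (g d , 1)) (range a n)

units-++ : ∀ g a b c → units g a (b + c) ≡ units g a b ++ units g (a + b) c
units-++ g a b c = trans (cong (map _) (range-++ a b c)) (map-++ _ (range a b) (range (a + b) c))

totalLabels-units : ∀ g a n → totalLabels (units g a n) ≡ n
totalLabels-units g a zero    = refl
totalLabels-units g a (suc n) = cong suc (totalLabels-units g (suc a) n)

-- trunc r stops once r labels are used up, so it keeps a prefix xs whole only if xs has no label-free tail.
SuffixesLabelled : List Entry → Set
SuffixesLabelled []             = ⊤
SuffixesLabelled ((_ , c) ∷ xs) = 1 ≤ c + totalLabels xs × SuffixesLabelled xs

SuffixesLabelled-++ : ∀ xs ys → SuffixesLabelled xs → SuffixesLabelled ys → SuffixesLabelled (xs ++ ys)
SuffixesLabelled-++ []             ys _          sys = sys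
SuffixesLabelled-++ ((_ , c) ∷ xs) ys (lab , sxs) sys =
  ≤-trans lab (+-monoʳ-≤ c (subst (totalLabels xs ≤_) (sym (totalLabels-++ xs ys)) (m≤m+n _ _)))
  , SuffixesLabelled-++ xs ys sxs sys

SuffixesLabelled-units : ∀ g a n → SuffixesLabelled (units g a n)
SuffixesLabelled-units g a zero    = tt
SuffixesLabelled-units g a (suc n) = s≤s z≤n , SuffixesLabelled-units g (suc a) n

trunc-zero : ∀ xs → trunc 0 xs ≡ []
trunc-zero []      = refl
trunc-zero (_ ∷ _) = refl

trunc-++ : ∀ r xs ys → SuffixesLabelled xs → totalLabels xs ≤ r →
  trunc r (xs ++ ys) ≡ xs ++ trunc (r ∸ totalLabels xs) ys
trunc-++ r       []             ys _          _  = refl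
trunc-++ zero    ((p , c) ∷ xs) ys (lab , _)   le with () ← ≤-trans lab le
trunc-++ (suc r) ((p , c) ∷ xs) ys (_ , sxs) le
  rewrite m≤n⇒m⊓n≡m (≤-trans (m≤m+n c (totalLabels xs)) le)
        | trunc-++ (suc r ∸ c) xs ys sxs (subst (_≤ suc r ∸ c) (m+n∸m≡n c (totalLabels xs)) (∸-monoˡ-≤ c le))
        | ∸-+-assoc (suc r) c (totalLabels xs) = refl

trunc-++ˡ : ∀ r xs ys → r ≤ totalLabels xs → trunc r (xs ++ ys) ≡ trunc r xs
trunc-++ˡ r       []             ys z≤n = trunc-zero ys
trunc-++ˡ zero    (_ ∷ _)        ys _   = refl
trunc-++ˡ (suc r) ((p , c) ∷ xs) ys le =
  cong ((p , c ⊓ suc r) ∷_) (trunc-++ˡ (suc r ∸ c) xs ys (subst (suc r ∸ c ≤_) (m+n∸m≡n c (totalLabels xs)) (∸-monoˡ-≤ c le)))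

trunc-units : ∀ g a u n → u ≤ n → trunc u (units g a n) ≡ units g a u
trunc-units g a zero    n       _         = trunc-zero (units g a n)
trunc-units g a (suc u) (suc n) (s≤s u≤n) = cong ((g a , 1) ∷_) (trunc-units g (suc a) u n u≤n)

filterᵇ-units : ∀ (p : Entry → Bool) g {K K′} → K′ ≤ K →
  (∀ d → d ≤ K′ → p (g d , 1) ≡ true) → (∀ d → K′ < d → p (g d , 1) ≡ false) →
  filterᵇ p (units g 1 K) ≡ units g 1 K′
filterᵇ-units p g {K} {K′} K′≤K keep drop = begin
  filterᵇ p (units g 1 K)
    ≡⟨ cong (filterᵇ p ∘ units g 1) (sym (m+[n∸m]≡n K′≤K)) ⟩
  filterᵇ p (units g 1 (K′ + (K ∸ K′)))
    ≡⟨ cong (filterᵇ p) (units-++ g 1 K′ (K ∸ K′)) ⟩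
  filterᵇ p (units g 1 K′ ++ units g (suc K′) (K ∸ K′))
    ≡⟨ filterᵇ-++ p (units g 1 K′) _ ⟩
  filterᵇ p (units g 1 K′) ++ filterᵇ p (units g (suc K′) (K ∸ K′))
    ≡⟨ cong₂ _++_ (filterᵇ-all p (map⁺ (All-range 1 K′ (λ d _ d<1+K′ → keep d (≤-pred d<1+K′)))))
                  (filterᵇ-none p (map⁺ (All-range (suc K′) (K ∸ K′) (λ d K′<d _ → drop d K′<d)))) ⟩
  units g 1 K′ ++ []
    ≡⟨ ++-identityʳ _ ⟩
  units g 1 K′ ∎
  where open ≡-Reasoning

trunc-∷-≢[] : ∀ {r x xs} → 1 ≤ r → trunc r (x ∷ xs) ≢ []
trunc-∷-≢[] (s≤s _) ()

trunc-All : ∀ {P : Pos → Set} r xs → All (P ∘ proj₁) xs → All (P ∘ proj₁) (trunc r xs)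
trunc-All r       []      []         = []
trunc-All zero    (_ ∷ _) _          = []
trunc-All (suc r) ((p , c) ∷ xs) (px ∷ pxs) = px ∷ trunc-All (suc r ∸ c) xs pxs

stripLast : ℕ → List Entry → List Entry
stripLast k xs = reverse (stripR k (reverse xs))

unlabel : List Entry → List Entry
unlabel = map (λ e → (proj₁ e , 0))

stripR-[] : ∀ k → stripR k [] ≡ []
stripR-[] zero    = refl
stripR-[] (suc k) = refl

stripR-++ : ∀ k xs ys → stripR k (xs ++ ys) ≡ stripR k xs ++ stripR (k ∸ totalLabels xs) ys
stripR-++ zero    xs ys rewrite 0∸n≡0 (totalLabels xs) = refl
stripR-++ (suc k) []             ys = refl
stripR-++ (suc k) ((p , c) ∷ xs) ys
  rewrite stripR-++ (suc k ∸ c) xs ys | ∸-+-assoc (suc k) c (totalLabels xs) = refl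

stripLast-++ : ∀ k xs ys → stripLast k (xs ++ ys) ≡ stripLast (k ∸ totalLabels ys) xs ++ stripLast k ys
stripLast-++ k xs ys = begin
  reverse (stripR k (reverse (xs ++ ys)))
    ≡⟨ cong (reverse ∘ stripR k) (reverse-++ xs ys) ⟩
  reverse (stripR k (reverse ys ++ reverse xs))
    ≡⟨ cong reverse (stripR-++ k (reverse ys) (reverse xs)) ⟩
  reverse (stripR k (reverse ys) ++ stripR (k ∸ totalLabels (reverse ys)) (reverse xs))
    ≡⟨ reverse-++ (stripR k (reverse ys)) _ ⟩
  reverse (stripR (k ∸ totalLabels (reverse ys)) (reverse xs)) ++ stripLast k ys
    ≡⟨ cong (λ t → stripLast (k ∸ t) xs ++ stripLast k ys) (totalLabels-reverse ys) ⟩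
  stripLast (k ∸ totalLabels ys) xs ++ stripLast k ys ∎
  where open ≡-Reasoning

stripLast-single : ∀ k e → stripLast k (e ∷ []) ≡ (proj₁ e , proj₂ e ∸ k) ∷ []
stripLast-single zero    e = refl
stripLast-single (suc k) e rewrite stripR-[] (suc k ∸ proj₂ e) = refl

stripLast-zero : ∀ xs → stripLast 0 xs ≡ xs
stripLast-zero = reverse-involutive

stripLast-all : ∀ k xs → totalLabels xs ≤ k → stripLast k xs ≡ unlabel xs
stripLast-all k []             _  = cong reverse (stripR-[] k)
stripLast-all k ((p , c) ∷ xs) le = begin
  stripLast k ((p , c) ∷ [] ++ xs)
    ≡⟨ stripLast-++ k ((p , c) ∷ []) xs ⟩
  stripLast (k ∸ totalLabels xs) ((p , c) ∷ []) ++ stripLast k xs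
    ≡⟨ cong₂ _++_ (stripLast-single (k ∸ totalLabels xs) (p , c)) (stripLast-all k xs (≤-trans (m≤n+m _ c) le)) ⟩
  (p , c ∸ (k ∸ totalLabels xs)) ∷ unlabel xs
    ≡⟨ cong (λ l → (p , l) ∷ unlabel xs) (m≤n⇒m∸n≡0 (subst (_≤ k ∸ totalLabels xs) (m+n∸n≡m c (totalLabels xs)) (∸-monoˡ-≤ (totalLabels xs) le))) ⟩
  (p , 0) ∷ unlabel xs ∎
  where open ≡-Reasoning

totalLabels-unlabel : ∀ xs → totalLabels (unlabel xs) ≡ 0
totalLabels-unlabel []       = refl
totalLabels-unlabel (_ ∷ xs) = totalLabels-unlabel xs

-- The index shift

-- 𝒦_i ↦ 𝒦_{i+1}: after pruning, 𝒦_{i+1} is a copy of 𝒦_i, and L_0 ↦ N_1 since N_1 is the leaf left of 𝒦_1.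
shift : Pos → Pos
shift lstar      = lstar
shift (sup i)    = sup (suc i)
shift l0         = knot 1
shift (knot i)   = knot (suc i)
shift (ch i c d) = ch (suc i) c d

shiftE : Entry → Entry
shiftE (p , c) = (shift p , c)

shiftL : LEntry → LEntry
shiftL (p , ls) = (shift p , ls)

-- The positions occurring in 𝒦. Leaving out N_0 (which shift merges with L_0) and the chains below it makes
-- shift injective and compatible with the parent maps.
data IsNode : Pos → Set where
  is-lstar : IsNode lstar
  is-sup   : ∀ i → IsNode (sup i)
  is-l0    : IsNode l0
  is-knot  : ∀ i → IsNode (knot (suc i))
  is-ch    : ∀ i c d → IsNode (ch (suc i) c d)

shift-==P : ∀ {x y} → IsNode x → IsNode y → (shift x ==P shift y) ≡ (x ==P y)
shift-==P is-lstar      is-lstar      = refl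
shift-==P is-lstar      (is-sup _)    = refl
shift-==P is-lstar      is-l0         = refl
shift-==P is-lstar      (is-knot _)   = refl
shift-==P is-lstar      (is-ch _ _ _) = refl
shift-==P (is-sup _)    is-lstar      = refl
shift-==P (is-sup _)    (is-sup _)    = refl
shift-==P (is-sup _)    is-l0         = refl
shift-==P (is-sup _)    (is-knot _)   = refl
shift-==P (is-sup _)    (is-ch _ _ _) = refl
shift-==P is-l0         is-lstar      = refl
shift-==P is-l0         (is-sup _)    = refl
shift-==P is-l0         is-l0         = refl
shift-==P is-l0         (is-knot _)   = refl
shift-==P is-l0         (is-ch _ _ _) = refl
shift-==P (is-knot _)   is-lstar      = refl
shift-==P (is-knot _)   (is-sup _)    = refl
shift-==P (is-knot _)   is-l0         = refl
shift-==P (is-knot _)   (is-knot _)   = refl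
shift-==P (is-knot _)   (is-ch _ _ _) = refl
shift-==P (is-ch _ _ _) is-lstar      = refl
shift-==P (is-ch _ _ _) (is-sup _)    = refl
shift-==P (is-ch _ _ _) is-l0         = refl
shift-==P (is-ch _ _ _) (is-knot _)   = refl
shift-==P (is-ch _ _ _) (is-ch _ _ _) = refl

-- S_0 is not the image of a node, so it is harmless that parentP (shift (sup 0)) = just (sup 0).
isParent-shift : ∀ {q p} → IsNode q → IsNode p → isParent (parentP (shift q)) (shift p) ≡ isParent (parentK q) p
isParent-shift is-lstar             vp            = shift-==P (is-sup 0) vp
isParent-shift (is-sup zero)        is-lstar      = refl
isParent-shift (is-sup zero)        (is-sup _)    = refl
isParent-shift (is-sup zero)        is-l0         = refl
isParent-shift (is-sup zero)        (is-knot _)   = refl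
isParent-shift (is-sup zero)        (is-ch _ _ _) = refl
isParent-shift (is-sup (suc i))     vp            = shift-==P (is-sup i) vp
isParent-shift is-l0                vp            = shift-==P (is-sup 0) vp
isParent-shift (is-knot i)          vp            = shift-==P (is-sup (suc i)) vp
isParent-shift (is-ch i c zero)     vp            = refl
isParent-shift (is-ch i c (suc zero)) vp          = shift-==P (is-knot i) vp
isParent-shift (is-ch i c (suc (suc d))) vp       = shift-==P (is-ch i c (suc d)) vp

labelsAt-shift : ∀ {es p} → All (IsNode ∘ proj₁) es → IsNode p → labelsAt (map shiftL es) (shift p) ≡ labelsAt es p
labelsAt-shift []                          vp = refl
labelsAt-shift {(q , _) ∷ _} (vq ∷ nodes) vp rewrite shift-==P vq vp | labelsAt-shift nodes vp = refl

childrenOf-shift : ∀ {es p} → All (IsNode ∘ proj₁) es → IsNode p →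
  childrenOf parentP (map shiftL es) (shift p) ≡ map shift (childrenOf parentK es p)
childrenOf-shift {es} {p} nodes vp = begin
  map proj₁ (filterᵇ (isParentP (shift p)) (map shiftL es))
    ≡⟨ cong (map proj₁) (filterᵇ-map (isParentK p) (isParentP (shift p)) shiftL (All.map (λ vq → isParent-shift vq vp) nodes)) ⟩
  map proj₁ (map shiftL cs)
    ≡⟨ trans (sym (map-∘ cs)) (map-∘ cs) ⟩
  map shift (map proj₁ cs) ∎
  where
  open ≡-Reasoning
  isParentP isParentK : Pos → LEntry → Bool
  isParentP p e = isParent (parentP (proj₁ e)) p
  isParentK p e = isParent (parentK (proj₁ e)) p
  cs = filterᵇ (isParentK p) es

grow-shift : ∀ {es} f {p} → All (IsNode ∘ proj₁) es → IsNode p →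
  grow parentP (map shiftL es) f (shift p) ≡ grow parentK es f p
grow-shift zero    nodes vp = cong (λ ls → node ls []) (labelsAt-shift nodes vp)
grow-shift {es} (suc f) {p} nodes vp = cong₂ node (labelsAt-shift nodes vp) (begin
  map (grow parentP (map shiftL es) f) (childrenOf parentP (map shiftL es) (shift p))
    ≡⟨ cong (map _) (childrenOf-shift nodes vp) ⟩
  map (grow parentP (map shiftL es) f) (map shift cs)
    ≡⟨ sym (map-∘ cs) ⟩
  map (grow parentP (map shiftL es) f ∘ shift) cs
    ≡⟨ map-cong-local (All.map (λ vc → grow-shift f nodes vc) (map⁺ (filter⁺ (T? ∘ _) nodes))) ⟩
  map (grow parentK es f) cs ∎)
  where
  open ≡-Reasoning
  cs = childrenOf parentK es p

toTree-shift : ∀ {es} → All (IsNode ∘ proj₁) es →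
  toTree parentP (sup 1) (map shiftL es) ≡ toTree parentK (sup 0) es
toTree-shift {es} nodes =
  trans (cong (λ l → grow parentP (map shiftL es) (suc l) (sup 1)) (length-map shiftL es)) (grow-shift (suc (length es)) nodes (is-sup 0))

labelize-shift : ∀ a es → labelize a (map shiftE es) ≡ map shiftL (labelize a es)
labelize-shift a []             = refl
labelize-shift a ((p , c) ∷ es) = cong ((shift p , range a c) ∷_) (labelize-shift (a + c) es)

labelize-All : ∀ {P : Pos → Set} a es → All (P ∘ proj₁) es → All (P ∘ proj₁) (labelize a es)
labelize-All a []             []         = []
labelize-All a ((p , c) ∷ es) (pp ∷ pes) = pp ∷ labelize-All (a + c) es pes

PKtree-≡ : ∀ j lam s n a → prune j lam s (Klist j lam s n) ≡ map shiftE (Klist j lam s a) →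
  All (IsNode ∘ proj₁) (Klist j lam s a) → PKtree j lam s n ≡ Ktree j lam s a
PKtree-≡ j lam s n a pruned nodes = begin
  toTree parentP (sup 1) (labelize 1 (prune j lam s (Klist j lam s n)))
    ≡⟨ cong (toTree parentP (sup 1) ∘ labelize 1) pruned ⟩
  toTree parentP (sup 1) (labelize 1 (map shiftE (Klist j lam s a)))
    ≡⟨ cong (toTree parentP (sup 1)) (labelize-shift 1 (Klist j lam s a)) ⟩
  toTree parentP (sup 1) (map shiftL (labelize 1 (Klist j lam s a)))
    ≡⟨ toTree-shift (labelize-All 1 (Klist j lam s a) nodes) ⟩
  Ktree j lam s a ∎
  where open ≡-Reasoning

mutual
  ≈T-refl : ∀ t → t ≈T t
  ≈T-refl (node ls cs) = node≈ cs ↭-refl (Pointwise-refl cs)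

  Pointwise-refl : ∀ cs → Pointwise _≈T_ cs cs
  Pointwise-refl []       = []
  Pointwise-refl (c ∷ cs) = ≈T-refl c ∷ Pointwise-refl cs

data InSeg : ℕ → Pos → Set where
  in-sup  : ∀ i → InSeg i (sup i)
  in-l0   : InSeg 0 l0
  in-knot : ∀ i → InSeg i (knot i)
  in-ch   : ∀ i c d → InSeg i (ch i c d)

inK-InSeg : ∀ {i p} k → InSeg i p → inK k p ≡ (k ≡ᵇ i)
inK-InSeg k (in-sup i)    = refl
inK-InSeg k in-l0         = refl
inK-InSeg k (in-knot i)   = refl
inK-InSeg k (in-ch i c d) = refl

idxOf-InSeg : ∀ {i p} → InSeg i p → idxOf p ≡ i
idxOf-InSeg (in-sup i)    = refl
idxOf-InSeg in-l0         = refl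
idxOf-InSeg (in-knot i)   = refl
idxOf-InSeg (in-ch i c d) = refl

InSeg-shift : ∀ {i p} → InSeg i p → InSeg (suc i) (shift p)
InSeg-shift (in-sup i)    = in-sup (suc i)
InSeg-shift in-l0         = in-knot 1
InSeg-shift (in-knot i)   = in-knot (suc i)
InSeg-shift (in-ch i c d) = in-ch (suc i) c d

maxIdx-++ : ∀ xs ys → maxIdx (xs ++ ys) ≡ maxIdx xs ⊔ maxIdx ys
maxIdx-++ []       ys = refl
maxIdx-++ (x ∷ xs) ys = trans (cong (idxOf (proj₁ x) ⊔_) (maxIdx-++ xs ys)) (sym (⊔-assoc (idxOf (proj₁ x)) (maxIdx xs) (maxIdx ys)))

maxIdx-≤ : ∀ {b} xs → All (λ e → idxOf (proj₁ e) ≤ b) xs → maxIdx xs ≤ b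
maxIdx-≤ []       []         = z≤n
maxIdx-≤ (x ∷ xs) (px ∷ pxs) = ⊔-lub px (maxIdx-≤ xs pxs)

module _ (N L : ℕ → ℕ) (N-suc : ∀ i → N (suc i) ≡ N i + L i) (L-pos : ∀ i → 1 ≤ L i) where

  locate : ∀ a d → ∃₂ λ b r → a ≤ b × N a + suc d ≡ N b + r × 1 ≤ r × r ≤ L b
  locate a zero    = a , 1 , ≤-refl , refl , ≤-refl , L-pos a
  locate a (suc d) with locate a d
  ... | b , r , a≤b , eq , _ , r≤L with r <? L b
  ...   | yes r<L = b , suc r , a≤b , trans (+-suc (N a) (suc d)) (trans (cong suc eq) (sym (+-suc (N b) r))) , s≤s z≤n , r<L
  ...   | no  r≮L = suc b , 1 , ≤-trans a≤b (n≤1+n b) , eq′ , ≤-refl , L-pos (suc b)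
    where
    eq′ : N a + suc (suc d) ≡ N (suc b) + 1
    eq′ = trans (+-suc (N a) (suc d)) (trans (cong suc (trans eq (cong (N b +_) (≤-antisym r≤L (≮⇒≥ r≮L)))))
            (trans (cong suc (sym (N-suc b))) (+-comm 1 (N (suc b)))))

-- The remainder is taken in 1 … K₀ + 1: the last chain of a truncated segment is never empty.
ceil-divMod : ∀ K₀ t → ∃₂ λ q u → suc t ≡ q * suc K₀ + suc u × u ≤ K₀
ceil-divMod K₀ t = t / suc K₀ , t % suc K₀ , eq , ≤-pred (m%n<n t (suc K₀))
  where
  eq : suc t ≡ t / suc K₀ * suc K₀ + suc (t % suc K₀)
  eq = trans (cong suc (trans (m≡m%n+[m/n]*n t (suc K₀)) (+-comm (t % suc K₀) _))) (sym (+-suc _ (t % suc K₀)))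

module Construction (j′ lam′ s : ℕ) where

  j lam : ℕ
  j   = suc j′
  lam = suc lam′

  seg : ℕ → List Entry
  seg = segment j lam s

  prefix : ℕ → List Entry
  prefix m = (lstar , 1) ∷ concatMap seg (range 0 m)

  prefixLabels : ℕ → ℕ
  prefixLabels m = totalLabels (prefix m)

  weight : List Entry → ℕ
  weight xs = sum (map (λ e → leafWeight j (proj₁ e)) xs)

  chain : (i c u : ℕ) → List Entry
  chain i c u = units (ch i c) 1 u

  chains : (i q K : ℕ) → List Entry
  chains i q K = concatMap (λ c → chain i c K) (range 0 q)

  -- The truncations of 𝒦_i: r ≤ s labels of S_i only, or S_i, N_i, the chains 0 … q − 1 cut to K nodes
  -- and the first u nodes of chain q.
  segSup : ℕ → ℕ → List Entry
  segSup i zero    = []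
  segSup i (suc r) = (sup i , suc r) ∷ []

  segChains : (i q K u : ℕ) → List Entry
  segChains i q K u = (sup i , s) ∷ (knot i , 1) ∷ (chains i q K ++ chain i q u)

  totalLabels-chains : ∀ i a q K → totalLabels (concatMap (λ c → chain i c K) (range a q)) ≡ q * K
  totalLabels-chains i a zero    K = refl
  totalLabels-chains i a (suc q) K = begin
    totalLabels (chain i a K ++ concatMap (λ c → chain i c K) (range (suc a) q))
      ≡⟨ totalLabels-++ (chain i a K) _ ⟩
    totalLabels (chain i a K) + totalLabels (concatMap (λ c → chain i c K) (range (suc a) q))
      ≡⟨ cong₂ _+_ (totalLabels-units (ch i a) 1 K) (totalLabels-chains i (suc a) q K) ⟩
    K + q * K ∎
    where open ≡-Reasoning

  totalLabels-seg : ∀ i → totalLabels (seg (suc i)) ≡ s + suc (lam * (suc i * j))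
  totalLabels-seg i = cong (λ t → s + suc t) (totalLabels-chains (suc i) 0 lam (suc i * j))

  SuffixesLabelled-chains : ∀ i a q K → SuffixesLabelled (concatMap (λ c → chain i c K) (range a q))
  SuffixesLabelled-chains i a zero    K = tt
  SuffixesLabelled-chains i a (suc q) K =
    SuffixesLabelled-++ (chain i a K) _ (SuffixesLabelled-units (ch i a) 1 K) (SuffixesLabelled-chains i (suc a) q K)

  SuffixesLabelled-seg : ∀ i → SuffixesLabelled (seg i)
  SuffixesLabelled-seg zero    = ≤-trans (s≤s z≤n) (m≤n+m 1 s) , s≤s z≤n , tt
  SuffixesLabelled-seg (suc i) = ≤-trans (s≤s z≤n) (m≤n+m _ s) , s≤s z≤n , SuffixesLabelled-chains (suc i) 0 lam (suc i * j)

  SuffixesLabelled-prefix : ∀ m → SuffixesLabelled (prefix m)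
  SuffixesLabelled-prefix m = s≤s z≤n , segs 0 m
    where
    segs : ∀ a m → SuffixesLabelled (concatMap seg (range a m))
    segs a zero    = tt
    segs a (suc m) = SuffixesLabelled-++ (seg a) _ (SuffixesLabelled-seg a) (segs (suc a) m)

  totalLabels-seg-pos : ∀ i → 1 ≤ totalLabels (seg i)
  totalLabels-seg-pos zero    = m≤n+m 1 s
  totalLabels-seg-pos (suc i) = ≤-trans (s≤s z≤n) (m≤n+m _ s)

  prefix-++ : ∀ m k → prefix (m + suc k) ≡ prefix m ++ (seg m ++ concatMap seg (range (suc m) k))
  prefix-++ m k = cong ((lstar , 1) ∷_) (trans (cong (concatMap seg) (range-++ 0 m (suc k)))
    (concatMap-++ seg (range 0 m) (m ∷ range (suc m) k)))

  prefix-suc : ∀ m → prefix (suc m) ≡ prefix m ++ seg m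
  prefix-suc m = trans (cong prefix (+-comm 1 m)) (trans (prefix-++ m 0) (cong (prefix m ++_) (++-identityʳ (seg m))))

  prefixLabels-suc : ∀ m → prefixLabels (suc m) ≡ prefixLabels m + totalLabels (seg m)
  prefixLabels-suc m = trans (cong totalLabels (prefix-suc m)) (totalLabels-++ (prefix m) (seg m))

  m<prefixLabels : ∀ m → m < prefixLabels m
  m<prefixLabels zero    = s≤s z≤n
  m<prefixLabels (suc m) rewrite prefixLabels-suc m =
    subst (_≤ prefixLabels m + totalLabels (seg m)) (+-comm (suc m) 1) (+-mono-≤ (m<prefixLabels m) (totalLabels-seg-pos m))

  Klist-prefix : ∀ m r → r ≤ totalLabels (seg m) → Klist j lam s (prefixLabels m + r) ≡ prefix m ++ trunc r (seg m)
  Klist-prefix m r r≤ = begin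
    trunc n (prefix (suc n))
      ≡⟨ cong (trunc n ∘ prefix) (sym m+suc[n∸m]≡1+n) ⟩
    trunc n (prefix (m + suc (n ∸ m)))
      ≡⟨ cong (trunc n) (prefix-++ m (n ∸ m)) ⟩
    trunc n (prefix m ++ (seg m ++ rest))
      ≡⟨ trunc-++ n (prefix m) _ (SuffixesLabelled-prefix m) (m≤m+n (prefixLabels m) r) ⟩
    prefix m ++ trunc (n ∸ prefixLabels m) (seg m ++ rest)
      ≡⟨ cong (λ t → prefix m ++ trunc t (seg m ++ rest)) (m+n∸m≡n (prefixLabels m) r) ⟩
    prefix m ++ trunc r (seg m ++ rest)
      ≡⟨ cong (prefix m ++_) (trunc-++ˡ r (seg m) rest r≤) ⟩
    prefix m ++ trunc r (seg m) ∎
    where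
    open ≡-Reasoning
    n = prefixLabels m + r
    rest = concatMap seg (range (suc m) (n ∸ m))
    m+suc[n∸m]≡1+n : m + suc (n ∸ m) ≡ suc n
    m+suc[n∸m]≡1+n = trans (+-suc m (n ∸ m)) (cong suc (m+[n∸m]≡n (<⇒≤ (≤-trans (m<prefixLabels m) (m≤m+n _ r)))))

  trunc-seg-sup : ∀ i r → r ≤ s → trunc r (seg (suc i)) ≡ segSup (suc i) r
  trunc-seg-sup i zero    _   = refl
  trunc-seg-sup i (suc r) r≤s rewrite m≥n⇒m⊓n≡n r≤s | m≤n⇒m∸n≡0 r≤s = refl

  trunc-seg-chains : ∀ i q u → q < lam → u ≤ suc i * j →
    trunc (s + suc (q * (suc i * j) + u)) (seg (suc i)) ≡ segChains (suc i) q (suc i * j) u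
  trunc-seg-chains i q u q<lam u≤K = begin
    trunc (s + suc t) (head ++ chains (suc i) lam K)
      ≡⟨ trunc-++ (s + suc t) head _ (≤-trans (s≤s z≤n) (m≤n+m _ s) , s≤s z≤n , tt) (+-monoʳ-≤ s (s≤s z≤n)) ⟩
    head ++ trunc (s + suc t ∸ (s + 1)) (chains (suc i) lam K)
      ≡⟨ cong (λ x → head ++ trunc x (chains (suc i) lam K)) (trans (cong (_∸ (s + 1)) (sym (+-assoc s 1 t))) (m+n∸m≡n (s + 1) t)) ⟩
    head ++ trunc t (chains (suc i) lam K)
      ≡⟨ cong (λ xs → head ++ trunc t xs) (concatMap-range-split (λ c → chain (suc i) c K) q<lam) ⟩
    head ++ trunc t (chains (suc i) q K ++ (chain (suc i) q K ++ rest))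
      ≡⟨ cong (head ++_) (trunc-++ t (chains (suc i) q K) _ (SuffixesLabelled-chains (suc i) 0 q K)
           (subst (_≤ t) (sym (totalLabels-chains (suc i) 0 q K)) (m≤m+n _ u))) ⟩
    head ++ (chains (suc i) q K ++ trunc (t ∸ totalLabels (chains (suc i) q K)) (chain (suc i) q K ++ rest))
      ≡⟨ cong (λ x → head ++ (chains (suc i) q K ++ trunc x (chain (suc i) q K ++ rest)))
           (trans (cong (t ∸_) (totalLabels-chains (suc i) 0 q K)) (m+n∸m≡n (q * K) u)) ⟩
    head ++ (chains (suc i) q K ++ trunc u (chain (suc i) q K ++ rest))
      ≡⟨ cong (λ xs → head ++ (chains (suc i) q K ++ xs))
           (trans (trunc-++ˡ u (chain (suc i) q K) rest (subst (u ≤_) (sym (totalLabels-units (ch (suc i) q) 1 K)) u≤K))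
                  (trunc-units (ch (suc i) q) 1 u K u≤K)) ⟩
    segChains (suc i) q K u ∎
    where
    open ≡-Reasoning
    K = suc i * j
    t = q * K + u
    head = (sup (suc i) , s) ∷ (knot (suc i) , 1) ∷ []
    rest = concatMap (λ c → chain (suc i) c K) (range (suc q) (lam ∸ suc q))

  weight-++ : ∀ xs ys → weight (xs ++ ys) ≡ weight xs + weight ys
  weight-++ xs ys = trans (cong sum (map-++ _ xs ys)) (sum-++ (map (λ e → leafWeight j (proj₁ e)) xs) _)

  weight-units-below : ∀ i c a n → a + n ≤ i * j → weight (units (ch i c) a n) ≡ 0
  weight-units-below i c a zero    _ = refl
  weight-units-below i c a (suc n) a+n<K
    rewrite ≡ᵇ-false {a} {i * j} (<⇒≢ (<-≤-trans (m<m+n a z<s) a+n<K)) =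
    weight-units-below i c (suc a) n (subst (_≤ i * j) (+-suc a n) a+n<K)

  weight-chain-< : ∀ i c u → u < i * j → weight (chain i c u) ≡ 0
  weight-chain-< i c u = weight-units-below i c 1 u

  weight-chain-full : ∀ i c → weight (chain (suc i) c (suc i * j)) ≡ j
  weight-chain-full i c = begin
    weight (units (ch (suc i) c) 1 (suc k))
      ≡⟨ cong (weight ∘ units (ch (suc i) c) 1) (+-comm 1 k) ⟩
    weight (units (ch (suc i) c) 1 (k + 1))
      ≡⟨ cong weight (units-++ (ch (suc i) c) 1 k 1) ⟩
    weight (units (ch (suc i) c) 1 k ++ (ch (suc i) c (suc k) , 1) ∷ [])
      ≡⟨ weight-++ (units (ch (suc i) c) 1 k) _ ⟩
    weight (units (ch (suc i) c) 1 k) + ((if suc k ≡ᵇ suc k then j else 0) + 0)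
      ≡⟨ cong₂ (λ a b → a + ((if b then j else 0) + 0)) (weight-units-below (suc i) c 1 k ≤-refl) (≡ᵇ-refl (suc k)) ⟩
    j + 0
      ≡⟨ +-identityʳ j ⟩
    j ∎
    where
    open ≡-Reasoning
    k = j′ + i * j

  weight-chains : ∀ i a q → weight (concatMap (λ c → chain (suc i) c (suc i * j)) (range a q)) ≡ q * j
  weight-chains i a zero    = refl
  weight-chains i a (suc q) = trans (weight-++ (chain (suc i) a (suc i * j)) (concatMap (λ c → chain (suc i) c (suc i * j)) (range (suc a) q))) (cong₂ _+_ (weight-chain-full i a) (weight-chains i (suc a) q))

  weight-segChains : ∀ i q u → weight (segChains (suc i) q (suc i * j) u) ≡ q * j + weight (chain (suc i) q u)
  weight-segChains i q u = trans (weight-++ (chains (suc i) q (suc i * j)) (chain (suc i) q u)) (cong (_+ weight (chain (suc i) q u)) (weight-chains i 0 q))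

  weight-segSup : ∀ i r → weight (segSup i r) ≡ 0
  weight-segSup i zero    = refl
  weight-segSup i (suc r) = refl

  weight-prefix : ∀ m → weight (prefix (suc m)) ≡ 1 + (j + m * (lam * j))
  weight-prefix zero    = refl
  weight-prefix (suc m) = begin
    weight (prefix (suc (suc m)))
      ≡⟨ cong weight (prefix-suc (suc m)) ⟩
    weight (prefix (suc m) ++ seg (suc m))
      ≡⟨ weight-++ (prefix (suc m)) (seg (suc m)) ⟩
    weight (prefix (suc m)) + weight (seg (suc m))
      ≡⟨ cong₂ _+_ (weight-prefix m) (weight-chains m 0 lam) ⟩
    (1 + (j + m * (lam * j))) + lam * j
      ≡⟨ ring m j (lam * j) ⟩
    1 + (j + suc m * (lam * j)) ∎
    where
    open ≡-Reasoning
    ring : ∀ m j x → (1 + (j + m * x)) + x ≡ 1 + (j + suc m * x)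
    ring = solve-∀

  weight-trunc-sup : ∀ i r → r ≤ s → weight (trunc r (seg (suc i))) ≡ 0
  weight-trunc-sup i r r≤s = trans (cong weight (trunc-seg-sup i r r≤s)) (weight-segSup (suc i) r)

  weight-trunc-chains : ∀ i q u → q < lam → u < suc i * j → weight (trunc (s + suc (q * (suc i * j) + u)) (seg (suc i))) ≡ q * j
  weight-trunc-chains i q u q<lam u<K = trans (cong weight (trunc-seg-chains i q u q<lam (<⇒≤ u<K)))
    (trans (weight-segChains i q u) (trans (cong (q * j +_) (weight-chain-< (suc i) q u u<K)) (+-identityʳ (q * j))))

  segSup-≤ : ∀ i r → r ≤ s → r ≤ totalLabels (seg (suc i))
  segSup-≤ i r r≤s = subst (r ≤_) (sym (totalLabels-seg i)) (≤-trans r≤s (m≤m+n s _))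

  segChains-≤ : ∀ i q u → q < lam → u ≤ suc i * j → s + suc (q * (suc i * j) + u) ≤ totalLabels (seg (suc i))
  segChains-≤ i q u q<lam u≤K = subst (s + suc (q * K + u) ≤_) (sym (totalLabels-seg i))
    (+-monoʳ-≤ s (s≤s (≤-trans (+-monoʳ-≤ (q * K) u≤K) (≤-trans (≤-reflexive (+-comm (q * K) K)) (*-monoˡ-≤ K q<lam)))))
    where K = suc i * j

  w-prefix : ∀ m r → r ≤ totalLabels (seg m) → w j lam s (prefixLabels m + r) ≡ weight (prefix m) + weight (trunc r (seg m))
  w-prefix m r r≤ = trans (cong weight (Klist-prefix m r r≤)) (weight-++ (prefix m) _)

  prefixLabels-suc-suc : ∀ p → prefixLabels (suc (suc p)) ≡ prefixLabels (suc p) + (s + suc (lam * (suc p * j)))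
  prefixLabels-suc-suc p = trans (prefixLabels-suc (suc p)) (cong (prefixLabels (suc p) +_) (totalLabels-seg p))

  ∸-∸-≡ : ∀ {n a x} → n ≡ a + (s + x) → n ∸ s ∸ x ≡ a
  ∸-∸-≡ {_} {a} {x} refl = trans (∸-+-assoc (a + (s + x)) s x) (m+n∸n≡m a (s + x))

  target-within : ∀ p n x r′ → n ≡ prefixLabels (suc (suc p)) + (x + j) → x ≤ totalLabels (seg (suc (suc p))) →
    x ≡ r′ + weight (trunc x (seg (suc (suc p)))) →
    n ∸ s ∸ w j lam s (n ∸ j) ≡ prefixLabels (suc p) + r′
  target-within p n x r′ n≡ x≤ x≡ = ∸-∸-≡ (begin
    n
      ≡⟨ trans n≡ (cong₂ (λ a b → a + (b + j)) (prefixLabels-suc-suc p) x≡) ⟩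
    (P₁ + (s + suc (lam * (suc p * j)))) + ((r′ + W) + j)
      ≡⟨ ring P₁ s lam p j r′ W ⟩
    (P₁ + r′) + (s + ((1 + (j + suc p * (lam * j))) + W))
      ≡⟨ cong (λ y → (P₁ + r′) + (s + y)) (sym w[n∸j]) ⟩
    (P₁ + r′) + (s + w j lam s (n ∸ j)) ∎)
    where
    open ≡-Reasoning
    P₁ = prefixLabels (suc p)
    W = weight (trunc x (seg (suc (suc p))))
    n∸j : n ∸ j ≡ prefixLabels (suc (suc p)) + x
    n∸j = trans (cong (_∸ j) (trans n≡ (sym (+-assoc _ x j)))) (m+n∸n≡m _ j)
    w[n∸j] : w j lam s (n ∸ j) ≡ (1 + (j + suc p * (lam * j))) + W
    w[n∸j] = trans (cong (w j lam s) n∸j) (trans (w-prefix (suc (suc p)) x x≤) (cong (_+ W) (weight-prefix (suc p))))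
    ring : ∀ P₁ s l p j r′ W → (P₁ + (s + suc (l * (suc p * j)))) + ((r′ + W) + j) ≡ (P₁ + r′) + (s + ((1 + (j + suc p * (l * j))) + W))
    ring = solve-∀

  -- For r < j, position n − j falls into the last chain of 𝒦_{m-1}.
  ∸j-in-last-chain : ∀ p n r → n ≡ prefixLabels (suc (suc p)) + r → r < j →
    ∃ λ x → x < suc p * j × n ∸ j ≡ prefixLabels (suc p) + (s + suc (lam′ * (suc p * j) + x))
  ∸j-in-last-chain p n r n≡ r<j = x , x<K′ , trans (cong (_∸ j) n≡′) (m+n∸n≡m _ j)
    where
    open ≡-Reasoning
    P₁ = prefixLabels (suc p)
    K′ = suc p * j
    y = j ∸ suc r
    x = K′ ∸ suc y
    j≡ : j ≡ r + suc y
    j≡ = sym (trans (+-suc r y) (m+[n∸m]≡n r<j))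
    K′≡ : K′ ≡ x + suc y
    K′≡ = sym (m∸n+n≡m (≤-trans (≤-trans (m≤n+m (suc y) r) (≤-reflexive (sym j≡))) (m≤m+n j (p * j))))
    x<K′ : x < K′
    x<K′ = subst (x <_) (sym K′≡) (m<m+n x z<s)
    ring : ∀ P₁ s l K x y r → (P₁ + (s + suc ((x + suc y) + l * K))) + r ≡ (P₁ + (s + suc (l * K + x))) + (r + suc y)
    ring = solve-∀
    n≡′ : n ≡ (P₁ + (s + suc (lam′ * K′ + x))) + j
    n≡′ = begin
      n
        ≡⟨ trans n≡ (cong (_+ r) (prefixLabels-suc-suc p)) ⟩
      (P₁ + (s + suc (K′ + lam′ * K′))) + r
        ≡⟨ cong (λ t → (P₁ + (s + suc (t + lam′ * K′))) + r) K′≡ ⟩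
      (P₁ + (s + suc ((x + suc y) + lam′ * K′))) + r
        ≡⟨ ring P₁ s lam′ K′ x y r ⟩
      (P₁ + (s + suc (lam′ * K′ + x))) + (r + suc y)
        ≡⟨ cong (P₁ + (s + suc (lam′ * K′ + x)) +_) (sym j≡) ⟩
      (P₁ + (s + suc (lam′ * K′ + x))) + j ∎

  target-across : ∀ p n r → n ≡ prefixLabels (suc (suc p)) + r → r < j →
    n ∸ s ∸ w j lam s (n ∸ j) ≡ prefixLabels (suc p) + r
  target-across p n r n≡ r<j with ∸j-in-last-chain p n r n≡ r<j
  ... | x , x<K′ , n∸j≡ = ∸-∸-≡ (begin
    n
      ≡⟨ trans n≡ (cong (_+ r) (prefixLabels-suc-suc p)) ⟩
    (P₁ + (s + suc (lam * K′))) + r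
      ≡⟨ ring P₁ s lam′ j′ p r ⟩
    (P₁ + r) + (s + ((1 + (j + p * (lam * j))) + lam′ * j))
      ≡⟨ cong (λ t → (P₁ + r) + (s + t)) (sym w[n∸j]) ⟩
    (P₁ + r) + (s + w j lam s (n ∸ j)) ∎)
    where
    open ≡-Reasoning
    P₁ = prefixLabels (suc p)
    K′ = suc p * j
    w[n∸j] : w j lam s (n ∸ j) ≡ (1 + (j + p * (lam * j))) + lam′ * j
    w[n∸j] = trans (cong (w j lam s) n∸j≡) (trans (w-prefix (suc p) _ (segChains-≤ p lam′ x ≤-refl (<⇒≤ x<K′)))
      (cong₂ _+_ (weight-prefix p) (weight-trunc-chains p lam′ x ≤-refl x<K′)))
    ring : ∀ P₁ s l j′ p r → (P₁ + (s + suc (suc l * (suc p * suc j′)))) + r ≡ (P₁ + r) + (s + ((1 + (suc j′ + p * (suc l * suc j′))) + l * suc j′))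
    ring = solve-∀

  All-chains : ∀ {P : Pos → Set} i a q K → (∀ c d → P (ch i c d)) → All (P ∘ proj₁) (concatMap (λ c → chain i c K) (range a q))
  All-chains i a q K f = concat⁺ (map⁺ (All-range a q (λ c _ _ → map⁺ (All-range 1 K (λ d _ _ → f c d)))))

  All-segs : ∀ {P : Entry → Set} a k → (∀ b → a ≤ b → b < a + k → All P (seg b)) → All P (concatMap seg (range a k))
  All-segs a k f = concat⁺ (map⁺ (All-range a k f))

  InSeg-seg : ∀ i → All (InSeg i ∘ proj₁) (seg i)
  InSeg-seg zero    = in-sup 0 ∷ in-l0 ∷ []
  InSeg-seg (suc i) = in-sup (suc i) ∷ in-knot (suc i) ∷ All-chains (suc i) 0 lam (suc i * j) (in-ch (suc i))

  IsNode-seg : ∀ i → All (IsNode ∘ proj₁) (seg i)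
  IsNode-seg zero    = is-sup 0 ∷ is-l0 ∷ []
  IsNode-seg (suc i) = is-sup (suc i) ∷ is-knot i ∷ All-chains (suc i) 0 lam (suc i * j) (is-ch i)

  IsNode-prefix : ∀ m → All (IsNode ∘ proj₁) (prefix m)
  IsNode-prefix m = is-lstar ∷ All-segs 0 m (λ b _ _ → IsNode-seg b)

  shift-chain : ∀ i c u → map shiftE (chain i c u) ≡ chain (suc i) c u
  shift-chain i c u = sym (map-∘ (range 1 u))

  shift-chains : ∀ i q K → map shiftE (chains i q K) ≡ chains (suc i) q K
  shift-chains i q K = trans (map-concatMap shiftE _ (range 0 q)) (concatMap-cong (λ c → shift-chain i c K) (range 0 q))

  chains-zero : ∀ i a q → concatMap (λ c → chain i c 0) (range a q) ≡ []
  chains-zero i a zero    = refl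
  chains-zero i a (suc q) = chains-zero i (suc a) q

  shift-seg : ∀ a → map shiftE (seg a) ≡ (sup (suc a) , s) ∷ (knot (suc a) , 1) ∷ chains (suc a) lam (suc a * j ∸ j)
  shift-seg zero    = cong (λ xs → (sup 1 , s) ∷ (knot 1 , 1) ∷ xs)
    (sym (trans (cong (chains 1 lam) (trans (cong (_∸ j) (*-identityˡ j)) (n∸n≡0 j))) (chains-zero 1 0 lam)))
  shift-seg (suc a) = cong (λ xs → (sup (suc (suc a)) , s) ∷ (knot (suc (suc a)) , 1) ∷ xs)
    (trans (shift-chains (suc a) lam (suc a * j)) (cong (chains (suc (suc a)) lam) (sym (m+n∸m≡n j (suc a * j)))))

  keep₂ : ℕ → Entry → Bool
  keep₂ m e = not (del2 j m (proj₁ e))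

  step2-seg : ∀ m a → suc a < m → filterᵇ (keep₂ m) (seg (suc a)) ≡ map shiftE (seg a)
  step2-seg m a a<m = trans
    (cong (λ xs → (sup (suc a) , s) ∷ (knot (suc a) , 1) ∷ xs)
      (trans (filterᵇ-concatMap (keep₂ m) (λ c → chain (suc a) c (suc a * j)) (range 0 lam)) (concatMap-cong (λ c →
        filterᵇ-units (keep₂ m) (ch (suc a) c) (m∸n≤m (suc a * j) j)
          (λ d d≤ → trans (cong (λ b → not (b ∧ ((suc a * j ∸ j) <ᵇ d))) (<ᵇ-true a<m)) (cong not (<ᵇ-false d≤)))
          (λ d d> → trans (cong (λ b → not (b ∧ ((suc a * j ∸ j) <ᵇ d))) (<ᵇ-true a<m)) (cong not (<ᵇ-true d>))))
        (range 0 lam))))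
    (sym (shift-seg a))

  step2-segs : ∀ m a k → a + k < m → filterᵇ (keep₂ m) (concatMap seg (range (suc a) k)) ≡ map shiftE (concatMap seg (range a k))
  step2-segs m a zero    _   = refl
  step2-segs m a (suc k) a+k<m = begin
    filterᵇ (keep₂ m) (seg (suc a) ++ concatMap seg (range (suc (suc a)) k))
      ≡⟨ filterᵇ-++ (keep₂ m) (seg (suc a)) _ ⟩
    filterᵇ (keep₂ m) (seg (suc a)) ++ filterᵇ (keep₂ m) (concatMap seg (range (suc (suc a)) k))
      ≡⟨ cong₂ _++_ (step2-seg m a (≤-<-trans (s≤s (m≤m+n a k)) (subst (_< m) (+-suc a k) a+k<m)))
                    (step2-segs m (suc a) k (subst (_< m) (+-suc a k) a+k<m)) ⟩
    map shiftE (seg a) ++ map shiftE (concatMap seg (range (suc a) k))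
      ≡⟨ sym (map-++ shiftE (seg a) _) ⟩
    map shiftE (concatMap seg (range a (suc k))) ∎
    where open ≡-Reasoning

  pruneAt : ℕ → List Entry → List Entry
  pruneAt m es = filterᵇ (λ e → not (inK m (proj₁ e))) es₂ ++ step3 j lam m (filterᵇ (λ e → inK m (proj₁ e)) es₂)
    where es₂ = step2 j m (step1 es)

  maxIdx-prefix : ∀ i E → E ≢ [] → All (InSeg (suc i) ∘ proj₁) E → maxIdx (prefix (suc i) ++ E) ≡ suc i
  maxIdx-prefix i []      E≢[] _        = ⊥-elim (E≢[] refl)
  maxIdx-prefix i (x ∷ E) _    (x∈ ∷ E∈) = ≤-antisym
    (maxIdx-≤ (prefix (suc i) ++ x ∷ E) (++⁺ (z≤n ∷ All-segs 0 (suc i) (λ b _ b<1+i → All.map (λ p∈ → ≤-trans (≤-reflexive (idxOf-InSeg p∈)) (<⇒≤ b<1+i)) (InSeg-seg b)))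
                                          (All.map (≤-reflexive ∘ idxOf-InSeg) (x∈ ∷ E∈))))
    (begin
      suc i                                                  ≡⟨ sym (idxOf-InSeg x∈) ⟩
      idxOf (proj₁ x)                                        ≤⟨ m≤m⊔n _ (maxIdx E) ⟩
      maxIdx (x ∷ E)                                         ≤⟨ m≤n⊔m (maxIdx (prefix (suc i))) _ ⟩
      maxIdx (prefix (suc i)) ⊔ maxIdx (x ∷ E)               ≡⟨ sym (maxIdx-++ (prefix (suc i)) (x ∷ E)) ⟩
      maxIdx (prefix (suc i) ++ x ∷ E) ∎)
    where open ≤-Reasoning

  keep₂-InSeg : ∀ i {p} → InSeg (suc i) p → not (del2 j (suc i) p) ≡ true
  keep₂-InSeg i (in-sup _)      = refl
  keep₂-InSeg i (in-knot _)     = refl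
  keep₂-InSeg i (in-ch _ c d) rewrite <ᵇ-false {suc i} ≤-refl = refl

  prune-prefix : ∀ i E → E ≢ [] → All (InSeg (suc i) ∘ proj₁) E →
    prune j lam s (prefix (suc i) ++ E) ≡ map shiftE (prefix i) ++ step3 j lam (suc i) E
  prune-prefix i E E≢[] E∈ = begin
    pruneAt (maxIdx (prefix (suc i) ++ E)) (prefix (suc i) ++ E)
      ≡⟨ cong (λ m → pruneAt m (prefix (suc i) ++ E)) (maxIdx-prefix i E E≢[] E∈) ⟩
    filterᵇ notInM (step2 j m (step1 (prefix m ++ E))) ++ step3 j lam m (filterᵇ inM (step2 j m (step1 (prefix m ++ E))))
      ≡⟨ cong (λ es → filterᵇ notInM es ++ step3 j lam m (filterᵇ inM es)) step₁₂ ⟩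
    filterᵇ notInM (shifted ++ E) ++ step3 j lam m (filterᵇ inM (shifted ++ E))
      ≡⟨ cong₂ (λ xs ys → xs ++ step3 j lam m ys)
           (trans (filterᵇ-++ notInM shifted E) (trans (cong₂ _++_ (filterᵇ-all notInM (All.map (cong not) shifted∉))
             (filterᵇ-none notInM (All.map (cong not) E∈m))) (++-identityʳ shifted)))
           (trans (filterᵇ-++ inM shifted E) (cong₂ _++_ (filterᵇ-none inM shifted∉) (filterᵇ-all inM E∈m))) ⟩
    shifted ++ step3 j lam m E ∎
    where
    open ≡-Reasoning
    m = suc i
    notInM inM : Entry → Bool
    notInM e = not (inK m (proj₁ e))
    inM e = inK m (proj₁ e)
    mids = concatMap seg (range 1 i)
    shifted = map shiftE (prefix i)
    E∈m : All (λ e → inM e ≡ true) E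
    E∈m = All.map (λ p∈ → trans (inK-InSeg m p∈) (≡ᵇ-refl m)) E∈
    shifted∉ : All (λ e → inM e ≡ false) shifted
    shifted∉ = refl ∷ map⁺ (All-segs 0 i (λ b _ b<i →
      All.map (λ p∈ → trans (inK-InSeg m (InSeg-shift p∈)) (≡ᵇ-false (>⇒≢ (s≤s b<i)))) (InSeg-seg b)))
    step₁ : step1 (prefix m ++ E) ≡ (lstar , 1) ∷ (mids ++ E)
    step₁ = cong ((lstar , 1) ∷_) (filterᵇ-all _ (++⁺
      (All-segs 1 i (λ b 1≤b _ → All.map (λ p∈ → cong not (trans (inK-InSeg 0 p∈) (≡ᵇ-false (<⇒≢ 1≤b)))) (InSeg-seg b)))
      (All.map (λ p∈ → cong not (inK-InSeg 0 p∈)) E∈)))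
    step₁₂ : step2 j m (step1 (prefix m ++ E)) ≡ shifted ++ E
    step₁₂ = trans (cong (step2 j m) step₁) (cong ((lstar , 1) ∷_) (trans (filterᵇ-++ (keep₂ m) mids E)
      (cong₂ _++_ (step2-segs m 0 i ≤-refl) (filterᵇ-all (keep₂ m) (All.map (keep₂-InSeg i) E∈)))))

  -- r and r′ are the numbers of labels of the last, truncated segment of 𝒦(n) and of 𝒦(a).
  record Shrinks (p r r′ : ℕ) : Set where
    field
      r′≤     : r′ ≤ totalLabels (seg (suc p))
      step3≡  : step3 j lam (suc (suc p)) (trunc r (seg (suc (suc p)))) ≡ map shiftE (trunc r′ (seg (suc p)))
      weight≡ : weight (trunc r (seg (suc (suc p)))) ≡ weight (trunc r′ (seg (suc p)))

  IsNode-Klist : ∀ a → All (IsNode ∘ proj₁) (Klist j lam s a)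
  IsNode-Klist a = trunc-All a (prefix (suc a)) (IsNode-prefix (suc a))

  module _ {p r r′ : ℕ} (1≤r : 1 ≤ r) (r≤ : r ≤ totalLabels (seg (suc (suc p)))) (sh : Shrinks p r r′) where
    open Shrinks sh
    open ≡-Reasoning
    private
      m = suc (suc p)
      E = trunc r (seg m)
      E′ = trunc r′ (seg (suc p))

    prune-Klist : prune j lam s (Klist j lam s (prefixLabels m + r)) ≡ map shiftE (Klist j lam s (prefixLabels (suc p) + r′))
    prune-Klist = begin
      prune j lam s (Klist j lam s (prefixLabels m + r))
        ≡⟨ cong (prune j lam s) (Klist-prefix m r r≤) ⟩
      prune j lam s (prefix m ++ E)
        ≡⟨ prune-prefix (suc p) E (trunc-∷-≢[] 1≤r) (trunc-All r (seg m) (InSeg-seg m)) ⟩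
      map shiftE (prefix (suc p)) ++ step3 j lam m E
        ≡⟨ cong (map shiftE (prefix (suc p)) ++_) step3≡ ⟩
      map shiftE (prefix (suc p)) ++ map shiftE E′
        ≡⟨ sym (trans (cong (map shiftE) (Klist-prefix (suc p) r′ r′≤)) (map-++ shiftE (prefix (suc p)) E′)) ⟩
      map shiftE (Klist j lam s (prefixLabels (suc p) + r′)) ∎

    w-Klist : w j lam s (prefixLabels m + r) ≡ w j lam s (prefixLabels (suc p) + r′) + lam * j
    w-Klist = begin
      w j lam s (prefixLabels m + r)
        ≡⟨ w-prefix m r r≤ ⟩
      weight (prefix m) + weight E
        ≡⟨ cong₂ _+_ (weight-prefix (suc p)) weight≡ ⟩
      (1 + (j + suc p * (lam * j))) + weight E′
        ≡⟨ ring j p (lam * j) (weight E′) ⟩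
      ((1 + (j + p * (lam * j))) + weight E′) + lam * j
        ≡⟨ cong (λ x → (x + weight E′) + lam * j) (sym (weight-prefix p)) ⟩
      (weight (prefix (suc p)) + weight E′) + lam * j
        ≡⟨ cong (_+ lam * j) (sym (w-prefix (suc p) r′ r′≤)) ⟩
      w j lam s (prefixLabels (suc p) + r′) + lam * j ∎
      where
      ring : ∀ j p x W → (1 + (j + suc p * x)) + W ≡ ((1 + (j + p * x)) + W) + x
      ring = solve-∀

  -- Step (3) on the truncations of a segment

  onChainᵉ : ℕ → ℕ → Entry → Bool
  onChainᵉ i c e = onChain i c (proj₁ e)

  length-chain : ∀ i c u → length (chain i c u) ≡ u
  length-chain i c u = trans (length-map _ (range 1 u)) (length-range 1 u)

  filter-onChain-same : ∀ i c u → filterᵇ (onChainᵉ i c) (chain i c u) ≡ chain i c u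
  filter-onChain-same i c u = filterᵇ-all (onChainᵉ i c) (map⁺ (All-range 1 u (λ _ _ _ →
    trans (cong (_∧ (c ≡ᵇ c)) (≡ᵇ-refl i)) (≡ᵇ-refl c))))

  filter-onChain-chain : ∀ i c c′ u → c ≢ c′ → filterᵇ (onChainᵉ i c) (chain i c′ u) ≡ []
  filter-onChain-chain i c c′ u c≢c′ = filterᵇ-none (onChainᵉ i c) (map⁺ (All-range 1 u (λ _ _ _ →
    trans (cong (_∧ (c ≡ᵇ c′)) (≡ᵇ-refl i)) (≡ᵇ-false c≢c′))))

  filter-onChain-chains : ∀ i c K a k → (∀ c′ → a ≤ c′ → c′ < a + k → c ≢ c′) →
    filterᵇ (onChainᵉ i c) (concatMap (λ c′ → chain i c′ K) (range a k)) ≡ []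
  filter-onChain-chains i c K a k c≢ = trans (filterᵇ-concatMap (onChainᵉ i c) (λ c′ → chain i c′ K) (range a k))
    (trans (concatMap-cong-local (All-range a k (λ c′ a≤c′ c′< → filter-onChain-chain i c c′ K (c≢ c′ a≤c′ c′<))))
           (concat-[] a k))
    where
    concat-[] : ∀ a k → concatMap (λ (_ : ℕ) → ([] {A = Entry})) (range a k) ≡ []
    concat-[] a zero    = refl
    concat-[] a (suc k) = concat-[] (suc a) k

  chainLen-segChains : ∀ i q K u c → chainLen i (segChains i q K u) c ≡
    length (filterᵇ (onChainᵉ i c) (chains i q K)) + length (filterᵇ (onChainᵉ i c) (chain i q u))
  chainLen-segChains i q K u c =
    trans (cong length (filterᵇ-++ (onChainᵉ i c) (chains i q K) (chain i q u))) (length-++ (filterᵇ (onChainᵉ i c) (chains i q K)))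

  chainLen-full : ∀ i q K u c → c < q → chainLen i (segChains i q K u) c ≡ K
  chainLen-full i q K u c c<q = begin
    chainLen i (segChains i q K u) c
      ≡⟨ chainLen-segChains i q K u c ⟩
    length (filterᵇ (onChainᵉ i c) (chains i q K)) + length (filterᵇ (onChainᵉ i c) (chain i q u))
      ≡⟨ cong₂ _+_ (cong length (trans (cong (filterᵇ (onChainᵉ i c)) (concatMap-range-split (λ c′ → chain i c′ K) c<q))
                     (trans (filterᵇ-++ (onChainᵉ i c) (concatMap _ (range 0 c)) _)
                       (cong₂ _++_ (filter-onChain-chains i c K 0 c (λ c′ _ c′<c → >⇒≢ c′<c))
                         (trans (filterᵇ-++ (onChainᵉ i c) (chain i c K) _)
                           (trans (cong₂ _++_ (filter-onChain-same i c K) (filter-onChain-chains i c K (suc c) (q ∸ suc c) (λ c′ c<c′ _ → <⇒≢ c<c′)))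
                             (++-identityʳ _)))))))
                   (cong length (filter-onChain-chain i c q u (<⇒≢ c<q))) ⟩
    length (chain i c K) + 0
      ≡⟨ trans (+-identityʳ _) (length-chain i c K) ⟩
    K ∎
    where open ≡-Reasoning

  chainLen-last : ∀ i q K u → chainLen i (segChains i q K u) q ≡ u
  chainLen-last i q K u = begin
    chainLen i (segChains i q K u) q
      ≡⟨ chainLen-segChains i q K u q ⟩
    length (filterᵇ (onChainᵉ i q) (chains i q K)) + length (filterᵇ (onChainᵉ i q) (chain i q u))
      ≡⟨ cong₂ _+_ (cong length (filter-onChain-chains i q K 0 q (λ c′ _ c′<q → >⇒≢ c′<q))) (cong length (filter-onChain-same i q u)) ⟩
    length (chain i q u)
      ≡⟨ length-chain i q u ⟩
    u ∎
    where open ≡-Reasoning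

  chainLen-beyond : ∀ i q K u c → q < c → chainLen i (segChains i q K u) c ≡ 0
  chainLen-beyond i q K u c q<c = trans (chainLen-segChains i q K u c)
    (cong₂ (λ xs ys → length xs + length ys) (filter-onChain-chains i c K 0 q (λ c′ _ c′<q → >⇒≢ (<-trans c′<q q<c)))
      (filter-onChain-chain i c q u (>⇒≢ q<c)))

  nChains-segChains : ∀ i q K u → q < lam → 1 ≤ K → nChains lam i (segChains i q K u) ≡ q + (1 ⊓ u)
  nChains-segChains i q K u q<lam 1≤K = begin
    length (filterᵇ started (range 0 lam))
      ≡⟨ cong (length ∘ filterᵇ started) (range-split q<lam) ⟩
    length (filterᵇ started (range 0 q ++ (q ∷ [] ++ rest)))
      ≡⟨ cong length (trans (filterᵇ-++ started (range 0 q) _) (cong (filterᵇ started (range 0 q) ++_) (filterᵇ-++ started (q ∷ []) rest))) ⟩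
    length (filterᵇ started (range 0 q) ++ (filterᵇ started (q ∷ []) ++ filterᵇ started rest))
      ≡⟨ cong₂ (λ xs ys → length (xs ++ (ys ++ filterᵇ started rest)))
           (filterᵇ-all started (All-range 0 q (λ c _ c<q → trans (cong (1 ≤ᵇ_) (chainLen-full i q K u c c<q)) (≤ᵇ-true 1≤K))))
           (trans (filterᵇ-single started q) (cong (λ b → if b then q ∷ [] else []) (cong (1 ≤ᵇ_) (chainLen-last i q K u)))) ⟩
    length (range 0 q ++ ((if 1 ≤ᵇ u then q ∷ [] else []) ++ filterᵇ started rest))
      ≡⟨ cong (λ xs → length (range 0 q ++ ((if 1 ≤ᵇ u then q ∷ [] else []) ++ xs)))
           (filterᵇ-none started (All-range (suc q) (lam ∸ suc q) (λ c q<c _ → cong (1 ≤ᵇ_) (chainLen-beyond i q K u c q<c)))) ⟩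
    length (range 0 q ++ ((if 1 ≤ᵇ u then q ∷ [] else []) ++ []))
      ≡⟨ trans (length-++ (range 0 q)) (cong₂ _+_ (length-range 0 q) (bit u)) ⟩
    q + (1 ⊓ u) ∎
    where
    open ≡-Reasoning
    started : ℕ → Bool
    started c = 1 ≤ᵇ chainLen i (segChains i q K u) c
    rest = range (suc q) (lam ∸ suc q)
    bit : ∀ u → length ((if 1 ≤ᵇ u then q ∷ [] else []) ++ []) ≡ 1 ⊓ u
    bit zero    = refl
    bit (suc u) = refl

  -- cleanup E = cleanupWith (1 ≤ᵇ totalLabels E) E; splitting off the flag lets it be rewritten separately.
  survives : Bool → Entry → Bool
  survives b e = (1 ≤ᵇ proj₂ e) ∨ (isSup (proj₁ e) ∧ b)

  cleanupWith : Bool → List Entry → List Entry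
  cleanupWith b = filterᵇ (survives b)

  cleanupWith-unlabel-units : ∀ b i c a n → cleanupWith b (unlabel (units (ch i c) a n)) ≡ []
  cleanupWith-unlabel-units b i c a zero    = refl
  cleanupWith-unlabel-units b i c a (suc n) = cleanupWith-unlabel-units b i c (suc a) n

  cleanup-sup : ∀ i x → cleanup ((sup i , x) ∷ []) ≡ segSup i x
  cleanup-sup i zero    = refl
  cleanup-sup i (suc x) = refl

  nChains-segSup : ∀ i r → nChains lam i (segSup i (suc r)) ≡ 0
  nChains-segSup i r = cong length (filterᵇ-none _ (All-range 0 lam (λ _ _ _ → refl)))

  step3-segSup : ∀ i r → step3 j lam i (segSup i (suc r)) ≡ (if j ≤ᵇ suc r then case3b j (segSup i (suc r)) else segSup i (suc r))
  step3-segSup i r = trans (cong (λ n → if 2 ≤ᵇ n then case3a j i E else (if j ≤ᵇ totalLabels E then case3b j E else E)) (nChains-segSup i r))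
    (cong (λ t → if j ≤ᵇ t then case3b j E else E) (+-identityʳ (suc r)))
    where E = segSup i (suc r)

  step3-sup-short : ∀ i r → suc r < j → step3 j lam i (segSup i (suc r)) ≡ segSup i (suc r)
  step3-sup-short i r r<j = trans (step3-segSup i r) (cong (λ b → if b then case3b j (segSup i (suc r)) else segSup i (suc r)) (≤ᵇ-false r<j))

  step3-sup-long : ∀ i r → j ≤ suc r → step3 j lam i (segSup i (suc r)) ≡ segSup i (suc r ∸ j)
  step3-sup-long i r j≤r = begin
    step3 j lam i (segSup i (suc r))
      ≡⟨ trans (step3-segSup i r) (cong (λ b → if b then case3b j (segSup i (suc r)) else segSup i (suc r)) (≤ᵇ-true j≤r)) ⟩
    cleanup (stripLast j ((sup i , suc r) ∷ []))
      ≡⟨ cong cleanup (stripLast-single j (sup i , suc r)) ⟩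
    cleanup ((sup i , suc r ∸ j) ∷ [])
      ≡⟨ cleanup-sup i (suc r ∸ j) ⟩
    segSup i (suc r ∸ j) ∎
    where open ≡-Reasoning

  step3-single : ∀ i K u → 1 ≤ K →
    step3 j lam i (segChains i 0 K u) ≡ (if j ≤ᵇ s + suc u then case3b j (segChains i 0 K u) else segChains i 0 K u)
  step3-single i K u 1≤K = trans
    (cong (λ b → if b then case3a j i E else (if j ≤ᵇ totalLabels E then case3b j E else E))
      (trans (cong (2 ≤ᵇ_) (nChains-segChains i 0 K u z<s 1≤K)) (lone u)))
    (cong (λ t → if j ≤ᵇ s + suc t then case3b j E else E) (totalLabels-units (ch i 0) 1 u))
    where
    E = segChains i 0 K u
    lone : ∀ u → (2 ≤ᵇ 0 + (1 ⊓ u)) ≡ false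
    lone zero    = refl
    lone (suc _) = refl

  step3-chain-short : ∀ i K u → 1 ≤ K → s + suc u < j → step3 j lam i (segChains i 0 K u) ≡ segChains i 0 K u
  step3-chain-short i K u 1≤K lt =
    trans (step3-single i K u 1≤K) (cong (λ b → if b then case3b j (segChains i 0 K u) else segChains i 0 K u) (≤ᵇ-false lt))

  step3-chain-long : ∀ i K u → 1 ≤ K → j ≤ u → step3 j lam i (segChains i 0 K u) ≡ segChains i 0 K (u ∸ j)
  step3-chain-long i K u 1≤K j≤u = begin
    step3 j lam i (segChains i 0 K u)
      ≡⟨ trans (step3-single i K u 1≤K) (cong (λ b → if b then case3b j E else E) (≤ᵇ-true (≤-trans j≤u (≤-trans (n≤1+n u) (m≤n+m (suc u) s))))) ⟩
    cleanup (stripLast j E)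
      ≡⟨ cong (cleanup ∘ stripLast j) E≡ ⟩
    cleanup (stripLast j ((pre ++ U₁) ++ U₂))
      ≡⟨ cong cleanup (stripLast-++ j (pre ++ U₁) U₂) ⟩
    cleanup (stripLast (j ∸ totalLabels U₂) (pre ++ U₁) ++ stripLast j U₂)
      ≡⟨ cong₂ (λ k xs → cleanup (stripLast k (pre ++ U₁) ++ xs))
           (trans (cong (j ∸_) (totalLabels-units (ch i 0) _ j)) (n∸n≡0 j)) (stripLast-all j U₂ (≤-reflexive (totalLabels-units (ch i 0) _ j))) ⟩
    cleanup (stripLast 0 (pre ++ U₁) ++ unlabel U₂)
      ≡⟨ cong (λ xs → cleanup (xs ++ unlabel U₂)) (stripLast-zero (pre ++ U₁)) ⟩
    cleanupWith (1 ≤ᵇ totalLabels ((pre ++ U₁) ++ unlabel U₂)) ((pre ++ U₁) ++ unlabel U₂)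
      ≡⟨ cong (λ b → cleanupWith b ((pre ++ U₁) ++ unlabel U₂)) labelled ⟩
    cleanupWith true ((pre ++ U₁) ++ unlabel U₂)
      ≡⟨ filterᵇ-++ (survives true) (pre ++ U₁) (unlabel U₂) ⟩
    cleanupWith true (pre ++ U₁) ++ cleanupWith true (unlabel U₂)
      ≡⟨ cong₂ _++_ (filterᵇ-all (survives true) (∨-zeroʳ (1 ≤ᵇ s) ∷ refl ∷ map⁺ (All-range 1 (u ∸ j) (λ _ _ _ → refl))))
                    (cleanupWith-unlabel-units true i 0 (suc (u ∸ j)) j) ⟩
    (pre ++ U₁) ++ []
      ≡⟨ ++-identityʳ (pre ++ U₁) ⟩
    segChains i 0 K (u ∸ j) ∎
    where
    open ≡-Reasoning
    E = segChains i 0 K u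
    pre = (sup i , s) ∷ (knot i , 1) ∷ []
    U₁ = units (ch i 0) 1 (u ∸ j)
    U₂ = units (ch i 0) (1 + (u ∸ j)) j
    E≡ : E ≡ (pre ++ U₁) ++ U₂
    E≡ = trans (cong (λ n → pre ++ units (ch i 0) 1 n) (sym (m∸n+n≡m j≤u)))
           (trans (cong (pre ++_) (units-++ (ch i 0) 1 (u ∸ j) j)) (sym (++-assoc pre U₁ U₂)))
    labelled : (1 ≤ᵇ totalLabels ((pre ++ U₁) ++ unlabel U₂)) ≡ true
    labelled rewrite totalLabels-++ (pre ++ U₁) (unlabel U₂) | totalLabels-unlabel U₂ | +-identityʳ (totalLabels (pre ++ U₁))
                   | totalLabels-units (ch i 0) 1 (u ∸ j) | +-suc s (u ∸ j) = refl

  step3-chain-to-sup : ∀ i K u y → 1 ≤ K → j ≡ u + suc y → y ≤ s → step3 j lam i (segChains i 0 K u) ≡ segSup i (s ∸ y)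
  step3-chain-to-sup i K u y 1≤K j≡ y≤s = begin
    step3 j lam i (segChains i 0 K u)
      ≡⟨ trans (step3-single i K u 1≤K) (cong (λ b → if b then case3b j E else E) (≤ᵇ-true j≤)) ⟩
    cleanup (stripLast j (pre ++ U))
      ≡⟨ cong cleanup (stripLast-++ j pre U) ⟩
    cleanup (stripLast (j ∸ totalLabels U) pre ++ stripLast j U)
      ≡⟨ cong₂ (λ k xs → cleanup (stripLast k pre ++ xs))
           (trans (cong (j ∸_) (totalLabels-units (ch i 0) 1 u)) j∸u) (stripLast-all j U (≤-trans (≤-reflexive (totalLabels-units (ch i 0) 1 u)) u≤j)) ⟩
    cleanup (stripLast (suc y) ((sup i , s) ∷ [] ++ (knot i , 1) ∷ []) ++ unlabel U)
      ≡⟨ cong (λ xs → cleanup (xs ++ unlabel U)) (trans (stripLast-++ (suc y) ((sup i , s) ∷ []) ((knot i , 1) ∷ []))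
           (cong₂ _++_ (stripLast-single y (sup i , s)) (trans (stripLast-single (suc y) (knot i , 1)) (cong (λ x → (knot i , x) ∷ []) (0∸n≡0 y))))) ⟩
    cleanup ((sup i , s ∸ y) ∷ (knot i , 0) ∷ unlabel U)
      ≡⟨ only-sup (s ∸ y) ⟩
    segSup i (s ∸ y) ∎
    where
    open ≡-Reasoning
    E = segChains i 0 K u
    pre = (sup i , s) ∷ (knot i , 1) ∷ []
    U = units (ch i 0) 1 u
    j∸u : j ∸ u ≡ suc y
    j∸u = trans (cong (_∸ u) j≡) (m+n∸m≡n u (suc y))
    u≤j : u ≤ j
    u≤j = subst (u ≤_) (sym j≡) (m≤m+n u (suc y))
    j≤ : j ≤ s + suc u
    j≤ = subst (_≤ s + suc u) (sym j≡) (subst (_≤ s + suc u) (sym (+-suc u y)) (subst (suc (u + y) ≤_) (sym (+-suc s u))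
           (s≤s (subst (u + y ≤_) (+-comm u s) (+-monoʳ-≤ u y≤s)))))
    only-sup : ∀ x → cleanup ((sup i , x) ∷ (knot i , 0) ∷ unlabel U) ≡ segSup i x
    only-sup zero    rewrite totalLabels-unlabel U = cleanupWith-unlabel-units false i 0 1 u
    only-sup (suc x) = cong ((sup i , suc x) ∷_) (cleanupWith-unlabel-units _ i 0 1 u)

  module _ (i q₀ K u₀ : ℕ) (q<lam : suc q₀ < lam) (j≤K : j ≤ K) where
    private
      q = suc q₀
      u = suc u₀
      E = segChains i q K u

    keep₃ : Entry → Bool
    keep₃ e = not (cut3 j i E (proj₁ e))

    keep₃-chain : ∀ c {len} → chainLen i E c ≡ len → ∀ d → keep₃ (ch i c d , 1) ≡ not ((j ≤ᵇ len) ∧ ((len ∸ j) <ᵇ d))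
    keep₃-chain c eq d = cong (λ l → not ((j ≤ᵇ l) ∧ ((l ∸ j) <ᵇ d))) eq

    step3-chains : ∀ u′ → filterᵇ keep₃ (chain i q u) ≡ chain i q u′ → step3 j lam i E ≡ segChains i q (K ∸ j) u′
    step3-chains u′ last = begin
      step3 j lam i E
        ≡⟨ cong (λ b → if b then case3a j i E else (if j ≤ᵇ totalLabels E then case3b j E else E))
             (trans (cong (2 ≤ᵇ_) (nChains-segChains i q K u q<lam (≤-trans (s≤s z≤n) j≤K))) (≤ᵇ-true (+-monoˡ-≤ 1 (s≤s (z≤n {q₀}))))) ⟩
      (sup i , s) ∷ (knot i , 1) ∷ filterᵇ keep₃ (chains i q K ++ chain i q u)
        ≡⟨ cong (λ xs → (sup i , s) ∷ (knot i , 1) ∷ xs) (filterᵇ-++ keep₃ (chains i q K) (chain i q u)) ⟩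
      (sup i , s) ∷ (knot i , 1) ∷ (filterᵇ keep₃ (chains i q K) ++ filterᵇ keep₃ (chain i q u))
        ≡⟨ cong₂ (λ xs ys → (sup i , s) ∷ (knot i , 1) ∷ (xs ++ ys)) cut-full last ⟩
      segChains i q (K ∸ j) u′ ∎
      where
      open ≡-Reasoning
      cut-full : filterᵇ keep₃ (chains i q K) ≡ chains i q (K ∸ j)
      cut-full = trans (filterᵇ-concatMap keep₃ (λ c → chain i c K) (range 0 q)) (concatMap-cong-local (All-range 0 q (λ c _ c<q →
        filterᵇ-units keep₃ (ch i c) (m∸n≤m K j)
          (λ d d≤ → trans (keep₃-chain c (chainLen-full i q K u c c<q) d) (cong₂ (λ a b → not (a ∧ b)) (≤ᵇ-true j≤K) (<ᵇ-false d≤)))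
          (λ d d> → trans (keep₃-chain c (chainLen-full i q K u c c<q) d) (cong₂ (λ a b → not (a ∧ b)) (≤ᵇ-true j≤K) (<ᵇ-true d>))))))

    step3-chains-long : j ≤ u → step3 j lam i E ≡ segChains i q (K ∸ j) (u ∸ j)
    step3-chains-long j≤u = step3-chains (u ∸ j) (filterᵇ-units keep₃ (ch i q) (m∸n≤m u j)
      (λ d d≤ → trans (keep₃-chain q (chainLen-last i q K u) d) (cong₂ (λ a b → not (a ∧ b)) (≤ᵇ-true j≤u) (<ᵇ-false d≤)))
      (λ d d> → trans (keep₃-chain q (chainLen-last i q K u) d) (cong₂ (λ a b → not (a ∧ b)) (≤ᵇ-true j≤u) (<ᵇ-true d>))))

    step3-chains-short : u < j → step3 j lam i E ≡ segChains i q (K ∸ j) u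
    step3-chains-short u<j = step3-chains u (filterᵇ-all keep₃ (map⁺ (All-range 1 u (λ d _ _ →
      trans (keep₃-chain q (chainLen-last i q K u) d) (cong (λ a → not (a ∧ ((u ∸ j) <ᵇ d))) (≤ᵇ-false u<j))))))

  shift-segSup : ∀ i r → map shiftE (segSup i r) ≡ segSup (suc i) r
  shift-segSup i zero    = refl
  shift-segSup i (suc r) = refl

  shift-segChains : ∀ i q K u → map shiftE (segChains i q K u) ≡ segChains (suc i) q K u
  shift-segChains i q K u = cong (λ xs → (sup (suc i) , s) ∷ (knot (suc i) , 1) ∷ xs)
    (trans (map-++ shiftE (chains i q K) (chain i q u)) (cong₂ _++_ (shift-chains i q K) (shift-chain i q u)))

  weight-chain-shorten : ∀ p c u → j ≤ u → u ≤ suc (suc p) * j → weight (chain (suc (suc p)) c u) ≡ weight (chain (suc p) c (u ∸ j))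
  weight-chain-shorten p c u j≤u u≤K with m≤n⇒m<n∨m≡n u≤K
  ... | inj₁ u<K = trans (weight-chain-< _ c u u<K) (sym (weight-chain-< _ c (u ∸ j)
          (+-cancelˡ-< j (u ∸ j) (suc p * j) (subst (_< suc (suc p) * j) (sym (m+[n∸m]≡n j≤u)) u<K))))
  ... | inj₂ refl = trans (weight-chain-full (suc p) c) (sym (trans (cong (weight ∘ chain (suc p) c) (m+n∸m≡n j (suc p * j))) (weight-chain-full p c)))

  mkShrinks : ∀ {p r r′ E E′} → trunc r (seg (suc (suc p))) ≡ E → trunc r′ (seg (suc p)) ≡ E′ → r′ ≤ totalLabels (seg (suc p)) →
    step3 j lam (suc (suc p)) E ≡ map shiftE E′ → weight E ≡ weight E′ → Shrinks p r r′
  mkShrinks refl refl r′≤ step3≡ weight≡ = record { r′≤ = r′≤ ; step3≡ = step3≡ ; weight≡ = weight≡ }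

  -- The seven cases

  module _ (p : ℕ) where
    private
      m = suc (suc p)
      K = m * j
      K′ = suc p * j
      1≤K : 1 ≤ K
      1≤K = s≤s z≤n
      j≤K′ : j ≤ K′
      j≤K′ = m≤m+n j (p * j)
      j≤K : j ≤ K
      j≤K = m≤m+n j K′

    shrinks-sup-short : ∀ r → suc r ≤ s → suc r < j → Shrinks p (suc r) (suc r)
    shrinks-sup-short r r≤s r<j = mkShrinks (trunc-seg-sup (suc p) (suc r) r≤s) (trunc-seg-sup p (suc r) r≤s) (segSup-≤ p (suc r) r≤s)
      (trans (step3-sup-short m r r<j) (sym (shift-segSup (suc p) (suc r)))) refl

    shrinks-sup-long : ∀ r → suc r ≤ s → j ≤ suc r → Shrinks p (suc r) (suc r ∸ j)
    shrinks-sup-long r r≤s j≤r = mkShrinks (trunc-seg-sup (suc p) (suc r) r≤s) (trunc-seg-sup p (suc r ∸ j) r∸j≤s) (segSup-≤ p (suc r ∸ j) r∸j≤s)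
      (trans (step3-sup-long m r j≤r) (sym (shift-segSup (suc p) (suc r ∸ j)))) (sym (weight-segSup (suc p) (suc r ∸ j)))
      where r∸j≤s = ≤-trans (m∸n≤m (suc r) j) r≤s

    shrinks-chain-short : ∀ u → s + suc u < j → Shrinks p (s + suc u) (s + suc u)
    shrinks-chain-short u r<j = mkShrinks (trunc-seg-chains (suc p) 0 u z<s (<⇒≤ u<K)) (trunc-seg-chains p 0 u z<s (<⇒≤ u<K′))
      (segChains-≤ p 0 u z<s (<⇒≤ u<K′))
      (trans (step3-chain-short m K u 1≤K r<j) (sym (shift-segChains (suc p) 0 K′ u)))
      (trans (weight-chain-< m 0 u u<K) (sym (weight-chain-< (suc p) 0 u u<K′)))
      where
      u<K′ : u < K′
      u<K′ = <-≤-trans (≤-<-trans (≤-trans (n≤1+n u) (m≤n+m (suc u) s)) r<j) j≤K′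
      u<K : u < K
      u<K = <-≤-trans u<K′ (m≤n+m K′ j)

    shrinks-chain-long : ∀ u → j ≤ u → u ≤ K → Shrinks p (s + suc u) (s + suc (u ∸ j))
    shrinks-chain-long u j≤u u≤K = mkShrinks (trunc-seg-chains (suc p) 0 u z<s u≤K) (trunc-seg-chains p 0 (u ∸ j) z<s u∸j≤K′)
      (segChains-≤ p 0 (u ∸ j) z<s u∸j≤K′)
      (trans (step3-chain-long m K u 1≤K j≤u) (sym (shift-segChains (suc p) 0 K′ (u ∸ j))))
      (weight-chain-shorten p 0 u j≤u u≤K)
      where
      u∸j≤K′ : u ∸ j ≤ K′
      u∸j≤K′ = subst (u ∸ j ≤_) (m+n∸m≡n j K′) (∸-monoˡ-≤ j u≤K)

    shrinks-chain-to-sup : ∀ u y → j ≡ u + suc y → y ≤ s → Shrinks p (s + suc u) (s ∸ y)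
    shrinks-chain-to-sup u y j≡ y≤s = mkShrinks (trunc-seg-chains (suc p) 0 u z<s (<⇒≤ u<K)) (trunc-seg-sup p (s ∸ y) (m∸n≤m s y))
      (segSup-≤ p (s ∸ y) (m∸n≤m s y))
      (trans (step3-chain-to-sup m K u y 1≤K j≡ y≤s) (sym (shift-segSup (suc p) (s ∸ y))))
      (trans (weight-chain-< m 0 u u<K) (sym (weight-segSup (suc p) (s ∸ y))))
      where
      u<K : u < K
      u<K = <-≤-trans (subst (u <_) (sym j≡) (m<m+n u z<s)) j≤K

    shrinks-chains-long : ∀ q₀ u₀ → suc q₀ < lam → suc u₀ ≤ K → j ≤ suc u₀ →
      Shrinks p (s + suc (suc q₀ * K + suc u₀)) (s + suc (suc q₀ * K′ + (suc u₀ ∸ j)))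
    shrinks-chains-long q₀ u₀ q<lam u≤K j≤u = mkShrinks (trunc-seg-chains (suc p) q u q<lam u≤K) (trunc-seg-chains p q (u ∸ j) q<lam u∸j≤K′)
      (segChains-≤ p q (u ∸ j) q<lam u∸j≤K′)
      (trans (step3-chains-long m q₀ K u₀ q<lam j≤K j≤u)
        (trans (cong (λ k → segChains m q k (u ∸ j)) (m+n∸m≡n j K′)) (sym (shift-segChains (suc p) q K′ (u ∸ j)))))
      (trans (weight-segChains (suc p) q u)
        (trans (cong (q * j +_) (weight-chain-shorten p q u j≤u u≤K)) (sym (weight-segChains p q (u ∸ j)))))
      where
      q = suc q₀
      u = suc u₀
      u∸j≤K′ : u ∸ j ≤ K′
      u∸j≤K′ = subst (u ∸ j ≤_) (m+n∸m≡n j K′) (∸-monoˡ-≤ j u≤K)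

    shrinks-chains-short : ∀ q₀ u₀ → suc q₀ < lam → suc u₀ < j →
      Shrinks p (s + suc (suc q₀ * K + suc u₀)) (s + suc (suc q₀ * K′ + suc u₀))
    shrinks-chains-short q₀ u₀ q<lam u<j = mkShrinks (trunc-seg-chains (suc p) q u q<lam (<⇒≤ u<K)) (trunc-seg-chains p q u q<lam (<⇒≤ u<K′))
      (segChains-≤ p q u q<lam (<⇒≤ u<K′))
      (trans (step3-chains-short m q₀ K u₀ q<lam j≤K u<j)
        (trans (cong (λ k → segChains m q k u) (m+n∸m≡n j K′)) (sym (shift-segChains (suc p) q K′ u))))
      (trans (weight-segChains (suc p) q u)
        (trans (cong (q * j +_) (trans (weight-chain-< m q u u<K) (sym (weight-chain-< (suc p) q u u<K′)))) (sym (weight-segChains p q u))))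
      where
      q = suc q₀
      u = suc u₀
      u<K′ : u < K′
      u<K′ = <-≤-trans u<j j≤K′
      u<K : u < K
      u<K = <-≤-trans u<K′ (m≤n+m K′ j)

  Goal : ℕ → Set
  Goal n = (PKtree j lam s n ≈T Ktree j lam s (n ∸ s ∸ w j lam s (n ∸ j)))
         × (w j lam s n ≡ w j lam s (n ∸ s ∸ w j lam s (n ∸ j)) + lam * j)

  module _ (p n r : ℕ) (n≡ : n ≡ prefixLabels (suc (suc p)) + r) (1≤r : 1 ≤ r) (r≤ : r ≤ totalLabels (seg (suc (suc p)))) where
    private
      m = suc (suc p)
      K = m * j
      K′ = suc p * j
      K′<K : K′ < K
      K′<K = m<n+m K′ z<s

    Shrinks⇒Goal : ∀ {r′} → Shrinks p r r′ → n ∸ s ∸ w j lam s (n ∸ j) ≡ prefixLabels (suc p) + r′ → Goal n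
    Shrinks⇒Goal {r′} sh a≡ = subst (PKtree j lam s n ≈T_) tree≡ (≈T-refl (PKtree j lam s n)) , weight≡′
      where
      tree≡ : PKtree j lam s n ≡ Ktree j lam s (n ∸ s ∸ w j lam s (n ∸ j))
      tree≡ = trans (cong (PKtree j lam s) n≡)
        (trans (PKtree-≡ j lam s (prefixLabels m + r) (prefixLabels (suc p) + r′) (prune-Klist 1≤r r≤ sh) (IsNode-Klist _)) (cong (Ktree j lam s) (sym a≡)))
      weight≡′ : w j lam s n ≡ w j lam s (n ∸ s ∸ w j lam s (n ∸ j)) + lam * j
      weight≡′ = trans (cong (w j lam s) n≡) (trans (w-Klist 1≤r r≤ sh) (cong (λ a → w j lam s a + lam * j) (sym a≡)))

    goal-across : r < j → Shrinks p r r → Goal n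
    goal-across r<j sh = Shrinks⇒Goal sh (target-across p n r n≡ r<j)

    -- x is the number of labels of 𝒦_m in 𝒦(n − j).
    goal-within : ∀ x r′ → r ≡ x + j → x ≡ r′ + weight (trunc x (seg m)) → Shrinks p r r′ → Goal n
    goal-within x r′ r≡ x≡ sh = Shrinks⇒Goal sh
      (target-within p n x r′ (trans n≡ (cong (prefixLabels m +_) r≡)) (≤-trans (m≤m+n x j) (subst (_≤ _) r≡ r≤)) x≡)

    goal-no-weight : ∀ x → r ≡ x + j → weight (trunc x (seg m)) ≡ 0 → Shrinks p r x → Goal n
    goal-no-weight x r≡ W≡0 = goal-within x x r≡ (sym (trans (cong (x +_) W≡0) (+-identityʳ x)))

    module _ (t : ℕ) (r≡ : r ≡ s + suc t) (j≤r : j ≤ r) where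

      goal-single : t ≤ K → Goal n
      goal-single t≤K with j ≤? t
      ... | yes j≤t = goal-no-weight (s + suc (t ∸ j))
              (trans r≡ (trans (cong (λ v → s + suc v) (sym (m∸n+n≡m j≤t))) (sym (+-assoc s (suc (t ∸ j)) j))))
              (weight-trunc-chains (suc p) 0 (t ∸ j) z<s (≤-<-trans t∸j≤K′ K′<K))
              (subst (λ r → Shrinks p r _) (sym r≡) (shrinks-chain-long p t j≤t t≤K))
        where
        t∸j≤K′ : t ∸ j ≤ K′
        t∸j≤K′ = subst (t ∸ j ≤_) (m+n∸m≡n j K′) (∸-monoˡ-≤ j t≤K)
      ... | no  j≰t = goal-no-weight (s ∸ y)
              (trans r≡ (trans (cong (_+ suc t) (sym (m∸n+n≡m y≤s))) (trans (ring (s ∸ y) y t) (cong (s ∸ y +_) (sym j≡)))))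
              (weight-trunc-sup (suc p) (s ∸ y) (m∸n≤m s y))
              (subst (λ r → Shrinks p r _) (sym r≡) (shrinks-chain-to-sup p t y j≡ y≤s))
        where
        y = j ∸ suc t
        j≡ : j ≡ t + suc y
        j≡ = sym (trans (+-suc t y) (m+[n∸m]≡n (≰⇒> j≰t)))
        y≤s : y ≤ s
        y≤s = +-cancelʳ-≤ (suc t) y s (subst₂ _≤_ (trans j≡ (trans (+-suc t y) (trans (cong suc (+-comm t y)) (sym (+-suc y t))))) r≡ j≤r)
        ring : ∀ a y t → (a + y) + suc t ≡ a + (t + suc y)
        ring = solve-∀

      goal-chains : ∀ q₀ u₀ → t ≡ suc q₀ * K + suc u₀ → suc u₀ ≤ K → Goal n
      goal-chains q₀ u₀ t≡ u≤K = by-cases (j ≤? u)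
        where
        q = suc q₀
        u = suc u₀
        r≡′ : r ≡ s + suc (q * K + u)
        r≡′ = trans r≡ (cong (λ v → s + suc v) t≡)
        q<lam : q < lam
        q<lam = *-cancelʳ-< K q lam (<-≤-trans (m<m+n (q * K) z<s)
          (subst (_≤ lam * K) t≡ (≤-pred (+-cancelˡ-≤ s (suc t) (suc (lam * K)) (subst₂ _≤_ r≡ (totalLabels-seg (suc p)) r≤)))))
        by-cases : Dec (j ≤ u) → Goal n
        by-cases (yes j≤u) = goal-within (s + suc (q * K + (u ∸ j))) (s + suc (q * K′ + (u ∸ j)))
            (trans r≡′ (trans (cong (λ v → s + suc (q * K + v)) (sym (m∸n+n≡m j≤u))) (ring₁ s q K (u ∸ j) j)))
            (trans (ring₂ s q j K′ (u ∸ j)) (cong (s + suc (q * K′ + (u ∸ j)) +_) (sym (weight-trunc-chains (suc p) q (u ∸ j) q<lam u∸j<K))))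
            (subst (λ r → Shrinks p r (s + suc (q * K′ + (u ∸ j)))) (sym r≡′) (shrinks-chains-long p q₀ u₀ q<lam u≤K j≤u))
          where
          u∸j<K : u ∸ j < K
          u∸j<K = ≤-<-trans (subst (u ∸ j ≤_) (m+n∸m≡n j K′) (∸-monoˡ-≤ j u≤K)) K′<K
          ring₁ : ∀ s q K v j → s + suc (q * K + (v + j)) ≡ (s + suc (q * K + v)) + j
          ring₁ = solve-∀
          ring₂ : ∀ s q j K′ v → s + suc (q * (j + K′) + v) ≡ (s + suc (q * K′ + v)) + q * j
          ring₂ = solve-∀
        by-cases (no j≰u) = goal-within (s + suc (q₀ * K + (K′ + u))) (s + suc (q * K′ + u))
            (trans r≡′ (ring₁ s q₀ j K′ u))
            (trans (ring₂ s q₀ j K′ u) (cong (s + suc (q * K′ + u) +_) (sym (weight-trunc-chains (suc p) q₀ (K′ + u) q₀<lam K′+u<K))))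
            (subst (λ r → Shrinks p r (s + suc (q * K′ + u))) (sym r≡′) (shrinks-chains-short p q₀ u₀ q<lam (≰⇒> j≰u)))
          where
          q₀<lam : q₀ < lam
          q₀<lam = <-trans (n<1+n q₀) q<lam
          K′+u<K : K′ + u < K
          K′+u<K = subst (K′ + u <_) (+-comm K′ j) (+-monoʳ-< K′ (≰⇒> j≰u))
          ring₁ : ∀ s q₀ j K′ u → s + suc (suc q₀ * (j + K′) + u) ≡ (s + suc (q₀ * (j + K′) + (K′ + u))) + j
          ring₁ = solve-∀
          ring₂ : ∀ s q₀ j K′ u → s + suc (q₀ * (j + K′) + (K′ + u)) ≡ (s + suc (suc q₀ * K′ + u)) + q₀ * j
          ring₂ = solve-∀

    r≡s+ : ¬ r ≤ s → r ≡ s + suc (r ∸ suc s)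
    r≡s+ r≰s = sym (trans (+-suc s (r ∸ suc s)) (m+[n∸m]≡n (≰⇒> r≰s)))

    goal-beyond-sup : ∀ t → r ≡ s + suc t → j ≤ r → Goal n
    goal-beyond-sup zero      r≡ j≤r = goal-single zero r≡ j≤r z≤n
    goal-beyond-sup (suc t₀) r≡ j≤r with ceil-divMod (j′ + suc p * j) t₀
    ... | zero   , u  , t≡ , u≤K₀ = goal-single (suc t₀) r≡ j≤r (subst (_≤ K) (sym t≡) (s≤s u≤K₀))
    ... | suc q₀ , u₀ , t≡ , u≤K₀ = goal-chains (suc t₀) r≡ j≤r q₀ u₀ t≡ (s≤s u≤K₀)

    goal : Goal n
    goal with r ≤? s | r <? j
    ... | yes r≤s | yes r<j = goal-across r<j (subst (λ x → Shrinks p x x) r≡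
            (shrinks-sup-short p (r ∸ 1) (subst (_≤ s) (sym r≡) r≤s) (subst (_< j) (sym r≡) r<j)))
      where r≡ = m+[n∸m]≡n 1≤r
    ... | yes r≤s | no  r≮j = goal-no-weight (r ∸ j) (sym (m∸n+n≡m j≤r)) (weight-trunc-sup (suc p) (r ∸ j) (≤-trans (m∸n≤m r j) r≤s))
            (subst (λ x → Shrinks p x (x ∸ j)) r≡ (shrinks-sup-long p (r ∸ 1) (subst (_≤ s) (sym r≡) r≤s) (subst (j ≤_) (sym r≡) j≤r)))
      where
      j≤r = ≮⇒≥ r≮j
      r≡ = m+[n∸m]≡n 1≤r
    ... | no  r≰s | yes r<j = goal-across r<j (subst (λ x → Shrinks p x x) (sym (r≡s+ r≰s)) (shrinks-chain-short p (r ∸ suc s) (subst (_< j) (r≡s+ r≰s) r<j)))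
    ... | no  r≰s | no  r≮j = goal-beyond-sup (r ∸ suc s) (r≡s+ r≰s) (≮⇒≥ r≮j)

  prefixLabels-2 : prefixLabels 2 ≡ 3 + 2 * s + lam * j
  prefixLabels-2 = trans (prefixLabels-suc 1) (trans (cong (_+ totalLabels (seg 1)) (prefixLabels-suc 0))
    (trans (cong ((1 + (s + 1)) +_) (totalLabels-seg 0)) (ring s lam′ j′)))
    where
    ring : ∀ s l j′ → (1 + (s + 1)) + (s + suc (suc l * (1 * suc j′))) ≡ 3 + 2 * s + suc l * suc j′
    ring = solve-∀

  theorem : ∀ n → 3 + 2 * s + lam * j < n → Goal n
  theorem n N₂<n with locate prefixLabels (totalLabels ∘ seg) prefixLabels-suc totalLabels-seg-pos 2 (n ∸ suc (prefixLabels 2))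
  ... | suc (suc p) , r , s≤s (s≤s _) , n≡ , 1≤r , r≤ = goal p n r (trans n≡′ n≡) 1≤r r≤
    where
    n≡′ : n ≡ prefixLabels 2 + suc (n ∸ suc (prefixLabels 2))
    n≡′ = sym (trans (+-suc (prefixLabels 2) _) (m+[n∸m]≡n (subst (_< n) (sym prefixLabels-2) N₂<n)))

lemma1 : (j lam s n : ℕ) → 1 ≤ j → 1 ≤ lam → 3 + 2 * s + lam * j < n →
    (PKtree j lam s n ≈T Ktree j lam s (n ∸ s ∸ w j lam s (n ∸ j)))
      × (w j lam s n ≡ w j lam s (n ∸ s ∸ w j lam s (n ∸ j)) + lam * j)
lemma1 (suc j′) (suc lam′) s n _ _ = Construction.theorem j′ lam′ s n
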